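{- For any integers $m \ge k \ge 0$, $$D_{m,k} := \operatorname{denom}\!\left(\binom{m}{k} B_k\right) = \prod_{p \in \mathcal{P}_{m,k}} p,$$ where the set $\mathcal{P}_{m,k}$ of primes is defined as follows: (i) $\mathcal{P}_{m,k} = \emptyset$ if $k = 0$ or $k \ge 3$ is odd; (ii) if $k = 1$, then $\mathcal{P}_{m,1} = \emptyset$ when $m$ is even and $\mathcal{P}_{m,1} = \{2\}$ when $m$ is odd; (iii) if $k \ge 2$ is even, $\mathcal{P}_{m,k} = \{ p \text{ prime} : (p-1) \mid k \text{ and } p \nmid \binom{m}{k}\}$.
   Context: The Bernoulli numbers $B_k$ are defined by $\frac{t}{e^t-1} = \sum_{k\ge 0} B_k \frac{t^k}{k!}$. For a rational number $\rho = \nu/\delta$ in lowest terms with $\nu \in \mathbb{Z}$, $\delta \in \mathbb{N}$, $\operatorname{denom}(\rho) := \delta$. An empty product equals $1$. -}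

module Defs where

open import Data.Nat as ℕ using (ℕ; zero; suc; _!)
open import Data.Nat.Combinatorics using (_C_)
open import Data.Nat.Primality using (Prime; prime?)
open import Data.Nat.Divisibility using (_∣_; _∣?_)
open import Data.Nat.Properties using (_!≢0)
open import Data.Integer as ℤ using (+_)
open import Data.Rational as ℚ using (ℚ; 0ℚ; 1ℚ; _/_; ↧ₙ_)
open import Data.List using (List; []; _∷_; reverse; foldr; upTo; filter; zipWith; length)
open import Data.Product using (_×_)
open import Relation.Nullary using (¬_; Dec)
open import Relation.Nullary.Decidable using (_×-dec_; ¬?)
open import Relation.Binary.PropositionalEquality using (_≡_)

-- Coefficients of the formal power series (e^t - 1)/t = Σ t^n/(n+1)!
E : ℕ → ℚ
E n = (+ 1) / (suc n !)
  where instance nz : ℕ.NonZero (suc n !)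
                 nz = suc n !≢0

-- Coefficients c_0, …, c_n of the multiplicative inverse t/(e^t - 1) = Σ c_n t^n
-- of the series above, determined by Σ_{j ≤ n} c_j E_{n-j} = [n = 0].
-- invCoeffsRev n = [c_n, c_{n-1}, …, c_0]
invCoeffsRev : ℕ → List ℚ
invCoeffsRev zero = 1ℚ ∷ []
invCoeffsRev (suc n) = cn ∷ prev
  where
  prev : List ℚ
  prev = invCoeffsRev n
  -- c_{n+1} = - Σ_{j ≤ n} c_j E_{n+1-j};  prev paired with E_1, …, E_{n+1}
  cn : ℚ
  cn = ℚ.- foldr ℚ._+_ 0ℚ (zipWith ℚ._*_ prev (Data.List.map (λ i → E (suc i)) (upTo (suc n))))

head0 : List ℚ → ℚ
head0 [] = 0ℚ
head0 (x ∷ _) = x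

tdivExpm1Coeff : ℕ → ℚ
tdivExpm1Coeff k = head0 (invCoeffsRev k)

-- Bernoulli numbers: t/(e^t-1) = Σ B_k t^k / k!
B : ℕ → ℚ
B k = ((+ (k !)) / 1) ℚ.* tdivExpm1Coeff k

denom : ℚ → ℕ
denom q = ↧ₙ q

data InP (m k p : ℕ) : Set where
  k≡1 : k ≡ 1 → ¬ (2 ∣ m) → p ≡ 2 → InP m k p
  k-even : 2 ℕ.≤ k → 2 ∣ k → Prime p → (p ℕ.∸ 1) ∣ k → ¬ (p ∣ (m C k)) → InP m k p

module Submission where

-- The proof goes through Worpitzky's formula
--   B n = Σ_{j ≤ n} (-1)ʲ j! S(n,j) / (j+1)      (S the Stirling numbers of the second kind),
-- which holds because its right-hand side satisfies the recurrence Σ_{l ≤ n} C(n+1,l) B l = 0 that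
-- determines the coefficients of t/(eᵗ-1). Put surj n j = j! S(n,j). For a prime p = q+1, expanding the
-- power sum Σ_{i<p} iⁿ in falling factorials gives surj n q ≡ Σ_{i<p} iⁿ (mod p), which by Fermat is
-- ≡ -1 when q ∣ n and ≡ 0 otherwise; for composite j+1 ≠ 4 already (j+1) ∣ j!, and 4 ∣ surj n 3 for
-- even n. Hence, for even n, the product D of the primes p with (p-1) ∣ n makes D B n an integer prime
-- to D (von Staudt–Clausen), and for odd n ≥ 3, B n is an integer. As D is squarefree, multiplying by
-- C(m,k) cancels exactly the primes of D that divide C(m,k).

open import Relation.Binary.PropositionalEquality

open import Algebra.Structures using (IsCommutativeSemiring)

module FiniteSum {A : Set} {_+_ _*_ : A → A → A} {0# 1# : A}
  (isCommutativeSemiring : IsCommutativeSemiring _≡_ _+_ _*_ 0# 1#) where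

  open import Data.Nat as ℕ using (ℕ; zero; suc; _<_)
  open import Data.Product using (_,_)
  open import Data.Sum using (inj₁; inj₂)
  import Data.Nat.Properties as ℕ
  open IsCommutativeSemiring isCommutativeSemiring
    using (+-assoc; +-identityˡ; +-identityʳ; distribˡ; zeroʳ; +-isCommutativeSemigroup)
  open import Algebra.Bundles using (CommutativeSemigroup)

  private
    +-commutativeSemigroup : CommutativeSemigroup _ _
    +-commutativeSemigroup = record { isCommutativeSemigroup = +-isCommutativeSemigroup }

  open import Algebra.Properties.CommutativeSemigroup +-commutativeSemigroup using (interchange)
  open ≡-Reasoning

  ∑ : ℕ → (ℕ → A) → A
  ∑ zero    f = 0#
  ∑ (suc n) f = ∑ n f + f n

  ∑-cong-< : ∀ n {f g : ℕ → A} → (∀ i → i < n → f i ≡ g i) → ∑ n f ≡ ∑ n g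
  ∑-cong-< zero    eq = refl
  ∑-cong-< (suc n) eq = cong₂ _+_ (∑-cong-< n (λ i i<n → eq i (ℕ.m<n⇒m<1+n i<n))) (eq n ℕ.≤-refl)

  ∑-cong : ∀ n {f g : ℕ → A} → (∀ i → f i ≡ g i) → ∑ n f ≡ ∑ n g
  ∑-cong n eq = ∑-cong-< n (λ i _ → eq i)

  ∑-vanish : ∀ n {f : ℕ → A} → (∀ i → i < n → f i ≡ 0#) → ∑ n f ≡ 0#
  ∑-vanish zero    eq = refl
  ∑-vanish (suc n) {f} eq = begin
    ∑ n f + f n  ≡⟨ cong₂ _+_ (∑-vanish n (λ i i<n → eq i (ℕ.m<n⇒m<1+n i<n))) (eq n ℕ.≤-refl) ⟩
    0# + 0#      ≡⟨ +-identityʳ 0# ⟩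
    0#           ∎

  ∑-distrib-+ : ∀ n f g → ∑ n (λ i → f i + g i) ≡ ∑ n f + ∑ n g
  ∑-distrib-+ zero    f g = sym (+-identityʳ 0#)
  ∑-distrib-+ (suc n) f g = begin
    ∑ n (λ i → f i + g i) + (f n + g n)  ≡⟨ cong (_+ (f n + g n)) (∑-distrib-+ n f g) ⟩
    (∑ n f + ∑ n g) + (f n + g n)        ≡⟨ interchange (∑ n f) (∑ n g) (f n) (g n) ⟩
    (∑ n f + f n) + (∑ n g + g n)        ∎

  *-distribˡ-∑ : ∀ n c f → c * ∑ n f ≡ ∑ n (λ i → c * f i)
  *-distribˡ-∑ zero    c f = zeroʳ c
  *-distribˡ-∑ (suc n) c f = trans (distribˡ c (∑ n f) (f n)) (cong (_+ (c * f n)) (*-distribˡ-∑ n c f))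

  ∑-uncons : ∀ n f → ∑ (suc n) f ≡ f 0 + ∑ n (λ i → f (suc i))
  ∑-uncons zero    f = trans (+-identityˡ (f 0)) (sym (+-identityʳ (f 0)))
  ∑-uncons (suc n) f = trans (cong (_+ f (suc n)) (∑-uncons n f)) (+-assoc _ _ _)

  ∑-comm : ∀ n m (f : ℕ → ℕ → A) → ∑ n (λ i → ∑ m (f i)) ≡ ∑ m (λ j → ∑ n (λ i → f i j))
  ∑-comm zero    m f = sym (∑-vanish m (λ _ _ → refl))
  ∑-comm (suc n) m f = begin
    ∑ n (λ i → ∑ m (f i)) + ∑ m (f n)                  ≡⟨ cong (_+ ∑ m (f n)) (∑-comm n m f) ⟩
    ∑ m (λ j → ∑ n (λ i → f i j)) + ∑ m (f n)          ≡⟨ sym (∑-distrib-+ m _ (f n)) ⟩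
    ∑ m (λ j → ∑ n (λ i → f i j) + f n j)              ∎

  ∑-split : ∀ n k f → ∑ (n ℕ.+ k) f ≡ ∑ n f + ∑ k (λ i → f (n ℕ.+ i))
  ∑-split n zero    f = trans (cong (λ x → ∑ x f) (ℕ.+-identityʳ n)) (sym (+-identityʳ _))
  ∑-split n (suc k) f = begin
    ∑ (n ℕ.+ suc k) f                                        ≡⟨ cong (λ x → ∑ x f) (ℕ.+-suc n k) ⟩
    ∑ (n ℕ.+ k) f + f (n ℕ.+ k)                              ≡⟨ cong (_+ f (n ℕ.+ k)) (∑-split n k f) ⟩
    (∑ n f + ∑ k (λ i → f (n ℕ.+ i))) + f (n ℕ.+ k)          ≡⟨ +-assoc _ _ _ ⟩
    ∑ n f + (∑ k (λ i → f (n ℕ.+ i)) + f (n ℕ.+ k))          ∎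

  private
    ∑-extend : ∀ m k f → (∀ i → m ℕ.≤ i → f i ≡ 0#) → ∑ (m ℕ.+ k) f ≡ ∑ m f
    ∑-extend m k f tail = begin
      ∑ (m ℕ.+ k) f                     ≡⟨ ∑-split m k f ⟩
      ∑ m f + ∑ k (λ i → f (m ℕ.+ i))   ≡⟨ cong (∑ m f +_) (∑-vanish k (λ i _ → tail (m ℕ.+ i) (ℕ.m≤m+n m i))) ⟩
      ∑ m f + 0#                        ≡⟨ +-identityʳ _ ⟩
      ∑ m f                             ∎

  ∑-support : ∀ m n f → (∀ i → m ℕ.≤ i → f i ≡ 0#) → (∀ i → n ℕ.≤ i → f i ≡ 0#) → ∑ m f ≡ ∑ n f
  ∑-support m n f beyond-m beyond-n with ℕ.≤-total m n
  ... | inj₁ m≤n with ℕ.m≤n⇒∃[o]m+o≡n m≤n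
  ...   | k , refl = sym (∑-extend m k f beyond-m)
  ∑-support m n f beyond-m beyond-n | inj₂ n≤m with ℕ.m≤n⇒∃[o]m+o≡n n≤m
  ...   | k , refl = ∑-extend n k f beyond-n

  ∑-telescope : ∀ n (g u : ℕ → A) → (∀ i → g i + u (suc i) ≡ u i) → ∑ n g + u n ≡ u 0
  ∑-telescope zero    g u step = +-identityˡ (u 0)
  ∑-telescope (suc n) g u step = begin
    (∑ n g + g n) + u (suc n)  ≡⟨ +-assoc _ _ _ ⟩
    ∑ n g + (g n + u (suc n))  ≡⟨ cong (∑ n g +_) (step n) ⟩
    ∑ n g + u n                ≡⟨ ∑-telescope n g u step ⟩
    u 0                        ∎

module Primes where

  open import Data.Nat using (ℕ; _*_)
  import Data.Nat.Properties as ℕ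
  open import Data.Nat.ListAction using (product)
  open import Data.Nat.Divisibility using (_∣_; _∤_; divides; ∣-trans; ∣1⇒≡1; *-monoˡ-∣)
  open import Data.Nat.Primality using (Prime; euclidsLemma; prime⇒irreducible; ¬prime[1])
  open import Data.Nat.Coprimality using (Coprime; coprime-divisor)
  open import Data.List using ([]; _∷_; filter)
  open import Data.List.Relation.Unary.All as All using (All; []; _∷_)
  open import Data.List.Relation.Unary.Any using (here; there)
  open import Data.List.Membership.Propositional using (_∈_)
  open import Data.List.Relation.Unary.Unique.Propositional using (Unique)
  open import Data.List.Relation.Unary.AllPairs using ([]; _∷_)
  open import Data.Product using (Σ; _×_; _,_)
  open import Data.Sum using (inj₁; inj₂)
  open import Relation.Nullary using (yes; no; contradiction)
  open import Relation.Nullary.Decidable using (¬?)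
  open import Relation.Unary using (Pred; Decidable)
  open import Function using (_∘_)
  open import Data.Empty using (⊥-elim)
  open import Algebra.Properties.CommutativeSemigroup ℕ.*-commutativeSemigroup using (x∙yz≈y∙xz)

  ∤m∧∣m*n⇒∣n : ∀ {p m n} → Prime p → p ∤ m → p ∣ m * n → p ∣ n
  ∤m∧∣m*n⇒∣n {m = m} {n} pr p∤m p∣mn with euclidsLemma m n pr p∣mn
  ... | inj₁ p∣m = contradiction p∣m p∤m
  ... | inj₂ p∣n = p∣n

  prime∣prime⇒≡ : ∀ {p q} → Prime p → Prime q → p ∣ q → p ≡ q
  prime∣prime⇒≡ pr qr p∣q with prime⇒irreducible qr p∣q
  ... | inj₁ refl = ⊥-elim (¬prime[1] pr)
  ... | inj₂ p≡q  = p≡q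

  prime∤product : ∀ {p xs} → Prime p → All Prime xs → All (p ≢_) xs → p ∤ product xs
  prime∤product {xs = []}     pr []         []          p∣1 = ¬prime[1] (subst Prime (∣1⇒≡1 p∣1) pr)
  prime∤product {xs = x ∷ xs} pr (xr ∷ xsr) (p≢x ∷ p≢xs) p∣x*xs with euclidsLemma x (product xs) pr p∣x*xs
  ... | inj₁ p∣x  = p≢x (prime∣prime⇒≡ pr xr p∣x)
  ... | inj₂ p∣xs = prime∤product pr xsr p≢xs p∣xs

  product≡p*cofactor : ∀ {p xs} → Unique xs → All Prime xs → p ∈ xs → Σ ℕ λ d → product xs ≡ p * d × p ∤ d
  product≡p*cofactor {xs = x ∷ xs} (x≢xs ∷ _) (xr ∷ xsr) (here refl) = product xs , refl , prime∤product xr xsr x≢xs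
  product≡p*cofactor {p} {x ∷ xs} (x≢xs ∷ unique) (xr ∷ xsr) (there p∈xs) with product≡p*cofactor unique xsr p∈xs
  ... | d , xs≡pd , p∤d = x * d , trans (cong (x *_) xs≡pd) (x∙yz≈y∙xz x p d) , p∤xd
    where
    pr : Prime p
    pr = All.lookup xsr p∈xs
    p∤xd : p ∤ x * d
    p∤xd p∣xd with euclidsLemma x d pr p∣xd
    ... | inj₁ p∣x = All.lookup x≢xs p∈xs (sym (prime∣prime⇒≡ pr xr p∣x))
    ... | inj₂ p∣d = p∤d p∣d

  product∣ : ∀ {c xs} → Unique xs → All Prime xs → All (_∣ c) xs → product xs ∣ c
  product∣ {c} {[]}     _                []         []           = divides c (sym (ℕ.*-identityʳ c))
  product∣ {c} {x ∷ xs} (x≢xs ∷ unique) (xr ∷ xsr) (x∣c ∷ xs∣c) with product∣ unique xsr xs∣c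
  ... | divides c′ c≡c′*xs = subst (x * product xs ∣_) (sym c≡c′*xs) (*-monoˡ-∣ (product xs) x∣c′)
    where
    x∣c′ : x ∣ c′
    x∣c′ = ∤m∧∣m*n⇒∣n xr (prime∤product xr xsr x≢xs)
                      (subst (x ∣_) (trans c≡c′*xs (ℕ.*-comm c′ (product xs))) x∣c)

  coprime-* : ∀ {m a b} → Coprime m a → Coprime m b → Coprime m (a * b)
  coprime-* {m} {a} coprime-a coprime-b (d∣m , d∣ab) =
    coprime-b (d∣m , coprime-divisor (λ (e∣d , e∣a) → coprime-a (∣-trans e∣d d∣m , e∣a)) d∣ab)

  coprime-prime : ∀ {m p} → Prime p → p ∤ m → Coprime m p
  coprime-prime pr p∤m (d∣m , d∣p) with prime⇒irreducible pr d∣p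
  ... | inj₁ d≡1 = d≡1
  ... | inj₂ refl = contradiction d∣m p∤m

  coprime-product : ∀ {m xs} → All Prime xs → All (_∤ m) xs → Coprime m (product xs)
  coprime-product []         []            (_ , d∣1) = ∣1⇒≡1 d∣1
  coprime-product (xr ∷ xsr) (x∤m ∷ xs∤m) = coprime-* (coprime-prime xr x∤m) (coprime-product xsr xs∤m)

  product-filter : ∀ {p} {P : Pred ℕ p} (P? : Decidable P) xs →
                   product (filter (¬? ∘ P?) xs) * product (filter P? xs) ≡ product xs
  product-filter P? [] = refl
  product-filter P? (x ∷ xs) with P? x
  ... | yes _ = trans (x∙yz≈y∙xz (product (filter (¬? ∘ P?) xs)) x _) (cong (x *_) (product-filter P? xs))
  ... | no  _ = trans (ℕ.*-assoc x _ _) (cong (x *_) (product-filter P? xs))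

module Congruence where

  open import Data.Nat using (ℕ; zero; suc; _+_; _*_; _<_)
  import Data.Nat.Properties as ℕ
  open import Data.Nat.Divisibility using (_∣_; divides; ∣m+n∣m⇒∣n; n∣m*n)
  open import Data.Nat.Primality using (Prime)
  open import Data.Nat.Tactic.RingSolver using (solve)
  open import Data.List using (_∷_; [])
  open import Data.Product using (Σ; _,_)
  open import Data.Sum using (inj₁; inj₂)
  open import Relation.Nullary using (¬_)
  open import Relation.Binary.Bundles using (Setoid)
  open Primes using (∤m∧∣m*n⇒∣n)
  import Relation.Binary.Reasoning.Setoid as SetoidReasoning
  open FiniteSum ℕ.+-*-isCommutativeSemiring using (∑; ∑-vanish)

  infix 4 _≈_[mod_]

  -- Both sides are shifted so that no truncated subtraction occurs.
  _≈_[mod_] : ℕ → ℕ → ℕ → Set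
  a ≈ b [mod p ] = Σ ℕ λ x → Σ ℕ λ y → a + x * p ≡ b + y * p

  ≈-refl : ∀ {a p} → a ≈ a [mod p ]
  ≈-refl = 0 , 0 , refl

  ≈-reflexive : ∀ {a b p} → a ≡ b → a ≈ b [mod p ]
  ≈-reflexive refl = ≈-refl

  ≈-sym : ∀ {a b p} → a ≈ b [mod p ] → b ≈ a [mod p ]
  ≈-sym (x , y , eq) = y , x , sym eq

  ≈-trans : ∀ {a b c p} → a ≈ b [mod p ] → b ≈ c [mod p ] → a ≈ c [mod p ]
  ≈-trans {a} {b} {c} {p} (x , y , ab) (u , v , bc) = x + u , v + y , (begin
    a + (x + u) * p        ≡⟨ solve (a ∷ x ∷ u ∷ p ∷ []) ⟩
    (a + x * p) + u * p    ≡⟨ cong (_+ u * p) ab ⟩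
    (b + y * p) + u * p    ≡⟨ solve (b ∷ y ∷ u ∷ p ∷ []) ⟩
    (b + u * p) + y * p    ≡⟨ cong (_+ y * p) bc ⟩
    (c + v * p) + y * p    ≡⟨ solve (c ∷ v ∷ y ∷ p ∷ []) ⟩
    c + (v + y) * p        ∎)
    where open ≡-Reasoning

  ≈-setoid : ℕ → Setoid _ _
  ≈-setoid p = record
    { Carrier       = ℕ
    ; _≈_           = _≈_[mod p ]
    ; isEquivalence = record { refl = ≈-refl ; sym = ≈-sym ; trans = ≈-trans }
    }

  module ≈-Reasoning (p : ℕ) = SetoidReasoning (≈-setoid p)

  +-cong-≈ : ∀ {a b c d p} → a ≈ b [mod p ] → c ≈ d [mod p ] → a + c ≈ b + d [mod p ]
  +-cong-≈ {a} {b} {c} {d} {p} (x , y , ab) (u , v , cd) = x + u , y + v , (begin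
    a + c + (x + u) * p         ≡⟨ solve (a ∷ c ∷ x ∷ u ∷ p ∷ []) ⟩
    (a + x * p) + (c + u * p)   ≡⟨ cong₂ _+_ ab cd ⟩
    (b + y * p) + (d + v * p)   ≡⟨ solve (b ∷ d ∷ y ∷ v ∷ p ∷ []) ⟩
    b + d + (y + v) * p         ∎)
    where open ≡-Reasoning

  *-congˡ-≈ : ∀ {a b p} c → a ≈ b [mod p ] → c * a ≈ c * b [mod p ]
  *-congˡ-≈ {a} {b} {p} c (x , y , ab) = c * x , c * y , (begin
    c * a + c * x * p   ≡⟨ solve (c ∷ a ∷ x ∷ p ∷ []) ⟩
    c * (a + x * p)     ≡⟨ cong (c *_) ab ⟩
    c * (b + y * p)     ≡⟨ solve (c ∷ b ∷ y ∷ p ∷ []) ⟩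
    c * b + c * y * p   ∎)
    where open ≡-Reasoning

  *-cong-≈ : ∀ {a b c d p} → a ≈ b [mod p ] → c ≈ d [mod p ] → a * c ≈ b * d [mod p ]
  *-cong-≈ {a} {b} {c} {d} {p} ab cd = begin
    a * c  ≡⟨ ℕ.*-comm a c ⟩
    c * a  ≈⟨ *-congˡ-≈ c ab ⟩
    c * b  ≡⟨ ℕ.*-comm c b ⟩
    b * c  ≈⟨ *-congˡ-≈ b cd ⟩
    b * d  ∎
    where open ≈-Reasoning p

  ∣⇒≈0 : ∀ {a p} → p ∣ a → a ≈ 0 [mod p ]
  ∣⇒≈0 {a} (divides q eq) = 0 , q , trans (ℕ.+-identityʳ a) eq

  ≈0⇒∣ : ∀ {a p} → a ≈ 0 [mod p ] → p ∣ a
  ≈0⇒∣ {a} {p} (x , y , eq) =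
    ∣m+n∣m⇒∣n (subst (p ∣_) (trans (sym eq) (ℕ.+-comm a (x * p))) (n∣m*n y)) (n∣m*n x)

  ∑-cong-≈ : ∀ n {f g : ℕ → ℕ} {p} → (∀ i → i < n → f i ≈ g i [mod p ]) → ∑ n f ≈ ∑ n g [mod p ]
  ∑-cong-≈ zero    eq = ≈-refl
  ∑-cong-≈ (suc n) eq = +-cong-≈ (∑-cong-≈ n (λ i i<n → eq i (ℕ.m<n⇒m<1+n i<n))) (eq n ℕ.≤-refl)

  ∑-≈0 : ∀ n {f : ℕ → ℕ} {p} → (∀ i → i < n → p ∣ f i) → ∑ n f ≈ 0 [mod p ]
  ∑-≈0 n div = ≈-trans (∑-cong-≈ n (λ i i<n → ∣⇒≈0 (div i i<n))) (≈-reflexive (∑-vanish n (λ _ _ → refl)))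

  m+d≈m⇒∣d : ∀ {m d p} → m + d ≈ m [mod p ] → p ∣ d
  m+d≈m⇒∣d {m} {d} {p} (x , y , eq) = ≈0⇒∣ (x , y , ℕ.+-cancelˡ-≡ m _ _ (begin
    m + (d + x * p)   ≡⟨ sym (ℕ.+-assoc m d (x * p)) ⟩
    m + d + x * p     ≡⟨ eq ⟩
    m + y * p         ≡⟨ cong (m +_) (sym (ℕ.+-identityˡ (y * p))) ⟩
    m + (0 + y * p)   ∎))
    where open ≡-Reasoning

  ∣d⇒m+d≈m : ∀ {m d p} → p ∣ d → m + d ≈ m [mod p ]
  ∣d⇒m+d≈m {m} (divides q refl) = 0 , q , ℕ.+-identityʳ _

  private
    *-cancel-offset : ∀ {a d c p} → Prime p → ¬ (p ∣ c) → c * (a + d) ≈ c * a [mod p ] → a + d ≈ a [mod p ]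
    *-cancel-offset {a} {d} {c} {p} pr p∤c eq =
      ∣d⇒m+d≈m (∤m∧∣m*n⇒∣n pr p∤c (m+d≈m⇒∣d (subst (λ x → x ≈ c * a [mod p ]) (ℕ.*-distribˡ-+ c a d) eq)))

  *-cancelˡ-≈ : ∀ {a b c p} → Prime p → ¬ (p ∣ c) → c * a ≈ c * b [mod p ] → a ≈ b [mod p ]
  *-cancelˡ-≈ {a} {b} pr p∤c ca≈cb with ℕ.≤-total a b
  ... | inj₁ a≤b with ℕ.m≤n⇒∃[o]m+o≡n a≤b
  ...   | _ , refl = ≈-sym (*-cancel-offset pr p∤c (≈-sym ca≈cb))
  *-cancelˡ-≈ {a} {b} pr p∤c ca≈cb | inj₂ b≤a with ℕ.m≤n⇒∃[o]m+o≡n b≤a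
  ...   | _ , refl = *-cancel-offset pr p∤c ca≈cb

module Binomial where

  open import Data.Nat using (ℕ; zero; suc; _+_; _*_; _∸_; _^_; _<_; _≤_; _!)
  import Data.Nat.Properties as ℕ
  open import Data.Nat.Combinatorics
    using (_C_; nC1≡n; k>n⇒nCk≡0; nCk+nC[k+1]≡[n+1]C[k+1]; nCk≡nC[n∸k]; nCk≡n!/k![n-k]!; k![n∸k]!∣n!)
  open import Data.Nat.DivMod using (m/n*n≡m)
  open import Data.Nat.Divisibility using (_∣_; m∣m*n; >⇒∤)
  open import Data.Nat.Primality using (Prime)
  open import Data.Nat.Tactic.RingSolver using (solve-∀)
  open Primes using (∤m∧∣m*n⇒∣n)
  open FiniteSum ℕ.+-*-isCommutativeSemiring using (∑; ∑-cong; ∑-uncons; ∑-distrib-+; *-distribˡ-∑)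
  open import Algebra.Properties.CommutativeSemigroup ℕ.*-commutativeSemigroup using (x∙yz≈y∙xz)
  open ≡-Reasoning

  pascal : ∀ n k → suc n C suc k ≡ n C k + n C suc k
  pascal n k = sym (nCk+nC[k+1]≡[n+1]C[k+1] n k)

  nC[1+n]≡0 : ∀ n → n C suc n ≡ 0
  nC[1+n]≡0 n = k>n⇒nCk≡0 (ℕ.n<1+n n)

  [1+n]Cn≡1+n : ∀ n → suc n C n ≡ suc n
  [1+n]Cn≡1+n n = begin
    suc n C n              ≡⟨ nCk≡nC[n∸k] (ℕ.n≤1+n n) ⟩
    suc n C (suc n ∸ n)    ≡⟨ cong (suc n C_) (ℕ.m+n∸n≡m 1 n) ⟩
    suc n C 1              ≡⟨ nC1≡n (suc n) ⟩
    suc n                  ∎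

  [1+k]*[1+n]C[1+k]≡[1+n]*nCk : ∀ n k → suc k * (suc n C suc k) ≡ suc n * (n C k)
  [1+k]*[1+n]C[1+k]≡[1+n]*nCk zero    zero    = refl
  [1+k]*[1+n]C[1+k]≡[1+n]*nCk zero    (suc k) = ℕ.*-zeroʳ (suc (suc k))
  [1+k]*[1+n]C[1+k]≡[1+n]*nCk (suc n) zero    =
    trans (ℕ.+-identityʳ _) (trans (nC1≡n (suc (suc n))) (sym (ℕ.*-identityʳ _)))
  [1+k]*[1+n]C[1+k]≡[1+n]*nCk (suc n) (suc k) = begin
    suc (suc k) * (suc (suc n) C suc (suc k))   ≡⟨ cong (suc (suc k) *_) (pascal (suc n) (suc k)) ⟩
    suc (suc k) * (X + Y)                        ≡⟨ split-off-X (suc k) X Y ⟩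
    suc k * X + X + suc (suc k) * Y              ≡⟨ cong₂ (λ u v → u + X + v) ([1+k]*[1+n]C[1+k]≡[1+n]*nCk n k)
                                                                               ([1+k]*[1+n]C[1+k]≡[1+n]*nCk n (suc k)) ⟩
    suc n * (n C k) + X + suc n * (n C suc k)    ≡⟨ collect (suc n) (n C k) X (n C suc k) ⟩
    suc n * (n C k + n C suc k) + X              ≡⟨ cong (λ u → suc n * u + X) (sym (pascal n k)) ⟩
    suc n * X + X                                ≡⟨ ℕ.+-comm (suc n * X) X ⟩
    suc (suc n) * X                              ∎
    where
    X = suc n C suc k
    Y = suc n C suc (suc k)
    split-off-X : ∀ k x y → suc k * (x + y) ≡ k * x + x + suc k * y
    split-off-X = solve-∀
    collect : ∀ n a x b → n * a + x + n * b ≡ n * (a + b) + x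
    collect = solve-∀

  n*nCk≡[1+k]*nC[1+k]+k*nCk : ∀ n k → n * (n C k) ≡ suc k * (n C suc k) + k * (n C k)
  n*nCk≡[1+k]*nC[1+k]+k*nCk n k = ℕ.+-cancelˡ-≡ (n C k) _ _ (begin
    n C k + n * (n C k)                           ≡⟨⟩
    suc n * (n C k)                               ≡⟨ sym ([1+k]*[1+n]C[1+k]≡[1+n]*nCk n k) ⟩
    suc k * (suc n C suc k)                       ≡⟨ cong (suc k *_) (pascal n k) ⟩
    suc k * (n C k + n C suc k)                   ≡⟨ rearrange k (n C k) (n C suc k) ⟩
    n C k + (suc k * (n C suc k) + k * (n C k))   ∎)
    where
    rearrange : ∀ k a b → suc k * (a + b) ≡ a + (suc k * b + k * a)
    rearrange = solve-∀

  binomial-theorem : ∀ x n → suc x ^ n ≡ ∑ (suc n) (λ i → (n C i) * x ^ i)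
  binomial-theorem x zero    = refl
  binomial-theorem x (suc n) = begin
    suc x * suc x ^ n                                  ≡⟨ cong (suc x *_) (binomial-theorem x n) ⟩
    ∑ (suc n) F + x * ∑ (suc n) F                      ≡⟨ cong₂ _+_ ∑F≡1+∑G (*-distribˡ-∑ (suc n) x F) ⟩
    (1 + ∑ (suc n) G) + ∑ (suc n) (λ i → x * F i)      ≡⟨ cong (1 + ∑ (suc n) G +_) (∑-cong (suc n) (λ i → x∙yz≈y∙xz x (n C i) (x ^ i))) ⟩
    (1 + ∑ (suc n) G) + ∑ (suc n) H                    ≡⟨ ℕ.+-assoc 1 (∑ (suc n) G) (∑ (suc n) H) ⟩
    1 + (∑ (suc n) G + ∑ (suc n) H)                    ≡⟨ cong (1 +_) (sym (∑-distrib-+ (suc n) G H)) ⟩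
    1 + ∑ (suc n) (λ i → G i + H i)                    ≡⟨ cong (1 +_) (∑-cong (suc n) pascal-term) ⟩
    1 + ∑ (suc n) (λ i → (suc n C suc i) * x ^ suc i)    ≡⟨ sym (∑-uncons (suc n) (λ i → (suc n C i) * x ^ i)) ⟩
    ∑ (suc (suc n)) (λ i → (suc n C i) * x ^ i)          ∎
    where
    F G H : ℕ → ℕ
    F i = (n C i) * x ^ i
    G i = (n C suc i) * x ^ suc i
    H i = (n C i) * x ^ suc i
    ∑F≡1+∑G : ∑ (suc n) F ≡ 1 + ∑ (suc n) G
    ∑F≡1+∑G = begin
      ∑ (suc n) F               ≡⟨ ∑-uncons n F ⟩
      1 + ∑ n G                 ≡⟨ cong (1 +_) (sym (ℕ.+-identityʳ (∑ n G))) ⟩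
      1 + (∑ n G + 0)           ≡⟨ cong (λ c → 1 + (∑ n G + c)) (sym Gn≡0) ⟩
      1 + ∑ (suc n) G           ∎
      where
      Gn≡0 : (n C suc n) * x ^ suc n ≡ 0
      Gn≡0 = cong (_* x ^ suc n) {y = 0} (nC[1+n]≡0 n)
    pascal-term : ∀ i → G i + H i ≡ (suc n C suc i) * x ^ suc i
    pascal-term i = begin
      (n C suc i) * x ^ suc i + (n C i) * x ^ suc i  ≡⟨ sym (ℕ.*-distribʳ-+ (x ^ suc i) (n C suc i) (n C i)) ⟩
      (n C suc i + n C i) * x ^ suc i            ≡⟨ cong (_* x ^ suc i) (trans (ℕ.+-comm (n C suc i) (n C i)) (sym (pascal n i))) ⟩
      (suc n C suc i) * x ^ suc i                  ∎

  prime∣pCk : ∀ {p k} → Prime p → 0 < k → k < p → p ∣ p C k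
  prime∣pCk {suc p} {suc k} pr _ k<p =
    ∤m∧∣m*n⇒∣n pr (>⇒∤ k<p) (subst (suc p ∣_) (sym ([1+k]*[1+n]C[1+k]≡[1+n]*nCk p k)) (m∣m*n (p C k)))

  hockey-stick : ∀ n k → ∑ n (λ i → i C k) ≡ n C suc k
  hockey-stick zero    k = refl
  hockey-stick (suc n) k = begin
    ∑ n (λ i → i C k) + n C k  ≡⟨ cong (_+ n C k) (hockey-stick n k) ⟩
    n C suc k + n C k          ≡⟨ ℕ.+-comm (n C suc k) (n C k) ⟩
    n C k + n C suc k          ≡⟨ sym (pascal n k) ⟩
    suc n C suc k              ∎

  nCk*[k!*[n∸k]!]≡n! : ∀ {n k} → k ≤ n → (n C k) * (k ! * (n ∸ k) !) ≡ n !
  nCk*[k!*[n∸k]!]≡n! {n} {k} k≤n =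
    trans (cong (_* (k ! * (n ∸ k) !)) (nCk≡n!/k![n-k]! k≤n)) (m/n*n≡m (k![n∸k]!∣n! k≤n))
    where instance _ = k ℕ.!* (n ∸ k) !≢0

module PowerSum where

  open import Data.Nat using (ℕ; zero; suc; _+_; _*_; _^_; _<_; s≤s; z≤n)
  import Data.Nat.Properties as ℕ
  open import Data.Nat.Combinatorics using (_C_; nCn≡1)
  open import Data.Nat.DivMod using (_%_; _/_; m≡m%n+[m/n]*n; m%n<n)
  open import Data.Nat.Divisibility
    using (_∣_; divides; m∣m*n; ∣m⇒∣m*n; ∣n⇒∣m*n; ∣m+n∣m⇒∣n; m%n≡0⇒n∣m; >⇒∤; ∣-refl)
  open import Data.Nat.Primality using (Prime; ¬prime[1])
  open import Data.Nat.Induction using (<-rec)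
  open import Data.Nat.Tactic.RingSolver using (solve)
  open import Data.List using (_∷_; [])
  open import Data.Empty using (⊥-elim)
  open import Relation.Nullary using (¬_)
  open FiniteSum ℕ.+-*-isCommutativeSemiring
  open Primes using (∤m∧∣m*n⇒∣n)
  open Congruence
  open Binomial

  fermat : ∀ {p} → Prime p → ∀ a → a ^ p ≈ a [mod p ]
  fermat {suc q} pr zero    = ≈-refl
  fermat {p@(suc q)} pr (suc a) = begin
    suc a ^ p                                                      ≡⟨ binomial-theorem a p ⟩
    ∑ (suc p) (λ i → (p C i) * a ^ i)                              ≡⟨ ∑-uncons p _ ⟩
    1 + (∑ q (λ i → (p C suc i) * a ^ suc i) + (p C p) * a ^ p)    ≈⟨ +-cong-≈ (≈-refl {1}) (+-cong-≈ middle last) ⟩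
    1 + (0 + a ^ p)                                                ≈⟨ +-cong-≈ (≈-refl {1}) (fermat pr a) ⟩
    1 + a                                                          ∎
    where
    open ≈-Reasoning p
    middle : ∑ q (λ i → (p C suc i) * a ^ suc i) ≈ 0 [mod p ]
    middle = ∑-≈0 q (λ i i<q → ∣m⇒∣m*n (a ^ suc i) (prime∣pCk pr (s≤s z≤n) (s≤s i<q)))
    last : (p C p) * a ^ p ≈ a ^ p [mod p ]
    last = ≈-reflexive (trans (cong (_* a ^ p) (nCn≡1 p)) (ℕ.*-identityˡ (a ^ p)))

  fermat-≈1 : ∀ {q} → Prime (suc q) → ∀ {a} → ¬ (suc q ∣ a) → a ^ q ≈ 1 [mod suc q ]
  fermat-≈1 {q} pr {a} p∤a = *-cancelˡ-≈ pr p∤a (begin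
    a * a ^ q   ≈⟨ fermat pr a ⟩
    a           ≡⟨ sym (ℕ.*-identityʳ a) ⟩
    a * 1       ∎)
    where open ≈-Reasoning (suc q)

  ^-periodic : ∀ {q} → Prime (suc q) → ∀ {a} → ¬ (suc q ∣ a) → ∀ r k → a ^ (r + k * q) ≈ a ^ r [mod suc q ]
  ^-periodic pr {a} p∤a r zero    = ≈-reflexive (cong (a ^_) (ℕ.+-identityʳ r))
  ^-periodic {q} pr {a} p∤a r (suc k) = begin
    a ^ (r + suc k * q)        ≡⟨ cong (a ^_) exponent ⟩
    a ^ (q + (r + k * q))      ≡⟨ ℕ.^-distribˡ-+-* a q (r + k * q) ⟩
    a ^ q * a ^ (r + k * q)    ≈⟨ *-cong-≈ (fermat-≈1 pr p∤a) (^-periodic pr p∤a r k) ⟩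
    1 * a ^ r                  ≡⟨ ℕ.*-identityˡ (a ^ r) ⟩
    a ^ r                      ∎
    where
    open ≈-Reasoning (suc q)
    exponent : r + suc k * q ≡ q + (r + k * q)
    exponent = solve (r ∷ k ∷ q ∷ [])

  powerSum : ℕ → ℕ → ℕ
  powerSum n r = ∑ n (λ i → i ^ r)

  ∑-binomial-powerSum : ∀ n r → ∑ (suc r) (λ s → (suc r C s) * powerSum n s) ≡ n ^ suc r
  ∑-binomial-powerSum n r = ℕ.+-cancelʳ-≡ (powerSum n (suc r)) _ _ (begin
    ∑ (suc r) (λ s → (suc r C s) * powerSum n s) + powerSum n (suc r)
      ≡⟨ cong (λ c → ∑ (suc r) (λ s → (suc r C s) * powerSum n s) + c)
              (sym (trans (cong (_* powerSum n (suc r)) (nCn≡1 (suc r))) (ℕ.*-identityˡ _))) ⟩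
    ∑ (suc (suc r)) (λ s → (suc r C s) * powerSum n s)
      ≡⟨ ∑-cong (suc (suc r)) (λ s → *-distribˡ-∑ n (suc r C s) (λ i → i ^ s)) ⟩
    ∑ (suc (suc r)) (λ s → ∑ n (λ i → (suc r C s) * i ^ s))
      ≡⟨ sym (∑-comm n (suc (suc r)) (λ i s → (suc r C s) * i ^ s)) ⟩
    ∑ n (λ i → ∑ (suc (suc r)) (λ s → (suc r C s) * i ^ s))
      ≡⟨ ∑-cong n (λ i → sym (binomial-theorem i (suc r))) ⟩
    ∑ n (λ i → suc i ^ suc r)
      ≡⟨ sym (∑-uncons n (λ i → i ^ suc r)) ⟩
    powerSum n (suc r) + n ^ suc r
      ≡⟨ ℕ.+-comm (powerSum n (suc r)) (n ^ suc r) ⟩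
    n ^ suc r + powerSum n (suc r)
      ∎)
    where open ≡-Reasoning

  prime∣powerSum : ∀ {p} → Prime p → ∀ r → suc r < p → p ∣ powerSum p r
  prime∣powerSum {p} pr = <-rec _ step
    where
    open ≡-Reasoning
    step : ∀ r → (∀ {s} → s < r → suc s < p → p ∣ powerSum p s) → suc r < p → p ∣ powerSum p r
    step r ih r+1<p = ∤m∧∣m*n⇒∣n pr (>⇒∤ r+1<p) (∣m+n∣m⇒∣n p∣total p∣lower)
      where
      lower = ∑ r (λ s → (suc r C s) * powerSum p s)
      p∣lower : p ∣ lower
      p∣lower = ≈0⇒∣ (∑-≈0 r (λ s s<r → ∣n⇒∣m*n (suc r C s) (ih s<r (ℕ.<-trans (s≤s s<r) r+1<p))))
      p∣total : p ∣ lower + suc r * powerSum p r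
      p∣total = subst (p ∣_) (begin
        p ^ suc r                        ≡⟨ sym (∑-binomial-powerSum p r) ⟩
        lower + (suc r C r) * powerSum p r ≡⟨ cong (λ c → lower + c * powerSum p r) ([1+n]Cn≡1+n r) ⟩
        lower + suc r * powerSum p r     ∎) (m∣m*n (p ^ r))

  ∑1≡n : ∀ n → ∑ n (λ _ → 1) ≡ n
  ∑1≡n zero    = refl
  ∑1≡n (suc n) = trans (cong (_+ 1) (∑1≡n n)) (ℕ.+-comm n 1)

  powerSum-periodic : ∀ {q} → Prime (suc q) → ∀ r k → 0 < r →
                      powerSum (suc q) (r + k * q) ≈ powerSum (suc q) r [mod suc q ]
  powerSum-periodic {q} pr (suc r) k _ = begin
    powerSum (suc q) (suc r + k * q)       ≡⟨ ∑-uncons q _ ⟩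
    ∑ q (λ i → suc i ^ (suc r + k * q))    ≈⟨ ∑-cong-≈ q (λ i i<q → ^-periodic pr (>⇒∤ (s≤s i<q)) (suc r) k) ⟩
    ∑ q (λ i → suc i ^ suc r)              ≡⟨ sym (∑-uncons q _) ⟩
    powerSum (suc q) (suc r)               ∎
    where open ≈-Reasoning (suc q)

  powerSum+1≈0 : ∀ {q} → Prime (suc q) → ∀ {n} → 0 < n → q ∣ n → powerSum (suc q) n + 1 ≈ 0 [mod suc q ]
  powerSum+1≈0 {zero}       pr _   _                    = ⊥-elim (¬prime[1] pr)
  powerSum+1≈0 {q@(suc _)}  pr ()  (divides zero refl)
  powerSum+1≈0 {q@(suc _)}  pr 0<n (divides (suc k) refl) = begin
    powerSum (suc q) (q + k * q) + 1    ≈⟨ +-cong-≈ (powerSum-periodic pr q k (s≤s z≤n)) ≈-refl ⟩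
    powerSum (suc q) q + 1              ≡⟨ cong (_+ 1) (∑-uncons q _) ⟩
    ∑ q (λ i → suc i ^ q) + 1           ≈⟨ +-cong-≈ (∑-cong-≈ q (λ i i<q → fermat-≈1 pr (>⇒∤ (s≤s i<q)))) ≈-refl ⟩
    ∑ q (λ _ → 1) + 1                   ≡⟨ cong (_+ 1) (∑1≡n q) ⟩
    q + 1                               ≡⟨ ℕ.+-comm q 1 ⟩
    suc q                               ≈⟨ ∣⇒≈0 ∣-refl ⟩
    0                                   ∎
    where open ≈-Reasoning (suc q)

  ∤⇒prime∣powerSum : ∀ {q} → Prime (suc q) → ∀ {n} → ¬ (q ∣ n) → suc q ∣ powerSum (suc q) n
  ∤⇒prime∣powerSum {zero}      pr _       = ⊥-elim (¬prime[1] pr)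
  ∤⇒prime∣powerSum {q@(suc _)} pr {n} q∤n = ≈0⇒∣ (begin
    powerSum (suc q) n                        ≡⟨ cong (powerSum (suc q)) (m≡m%n+[m/n]*n n q) ⟩
    powerSum (suc q) (n % q + (n / q) * q)    ≈⟨ powerSum-periodic pr (n % q) (n / q) 0<n%q ⟩
    powerSum (suc q) (n % q)                  ≈⟨ ∣⇒≈0 (prime∣powerSum pr (n % q) (s≤s (m%n<n n q))) ⟩
    0                                         ∎)
    where
    open ≈-Reasoning (suc q)
    0<n%q : 0 < n % q
    0<n%q = ℕ.n≢0⇒n>0 (λ n%q≡0 → q∤n (m%n≡0⇒n∣m n q n%q≡0))

module Stirling where

  open import Data.Nat using (ℕ; zero; suc; _+_; _*_; _^_; _<_; s≤s; _!)
  import Data.Nat.Properties as ℕ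
  open import Data.Nat.Combinatorics using (_C_; nCn≡1)
  open import Data.Nat.Tactic.RingSolver using (solve-∀)
  import Algebra.Properties.CommutativeSemigroup as CommSemigroup
  open FiniteSum ℕ.+-*-isCommutativeSemiring
  open Binomial
  module +-CS = CommSemigroup ℕ.+-commutativeSemigroup
  module *-CS = CommSemigroup ℕ.*-commutativeSemigroup

  S₂ : ℕ → ℕ → ℕ
  S₂ zero    zero    = 1
  S₂ zero    (suc k) = 0
  S₂ (suc n) zero    = 0
  S₂ (suc n) (suc k) = suc k * S₂ n (suc k) + S₂ n k

  surj : ℕ → ℕ → ℕ
  surj n k = k ! * S₂ n k

  n<k⇒S₂≡0 : ∀ {n k} → n < k → S₂ n k ≡ 0
  n<k⇒S₂≡0 {zero}  {suc k} _         = refl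
  n<k⇒S₂≡0 {suc n} {suc k} (s≤s n<k) =
    cong₂ _+_ (trans (cong (suc k *_) (n<k⇒S₂≡0 (ℕ.m<n⇒m<1+n n<k))) (ℕ.*-zeroʳ (suc k))) (n<k⇒S₂≡0 n<k)

  n<k⇒surj≡0 : ∀ {n k} → n < k → surj n k ≡ 0
  n<k⇒surj≡0 {k = k} n<k = trans (cong (k ! *_) (n<k⇒S₂≡0 n<k)) (ℕ.*-zeroʳ (k !))

  ^≡∑S₂ : ∀ x n → x ^ n ≡ ∑ (suc n) (λ j → S₂ n j * (j ! * (x C j)))
  ^≡∑S₂ x zero    = refl
  ^≡∑S₂ x (suc n) = begin
    x * x ^ n                                                      ≡⟨ cong (x *_) (^≡∑S₂ x n) ⟩
    x * ∑ (suc n) F                                                ≡⟨ *-distribˡ-∑ (suc n) x F ⟩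
    ∑ (suc n) (λ j → x * F j)                                      ≡⟨ ∑-cong (suc n) absorb ⟩
    ∑ (suc n) (λ j → G j + H j)                                    ≡⟨ ∑-distrib-+ (suc n) G H ⟩
    ∑ (suc n) G + ∑ (suc n) H                                      ≡⟨ cong (∑ (suc n) G +_) ∑H≡∑K ⟩
    ∑ (suc n) G + ∑ (suc n) K                                      ≡⟨ sym (∑-distrib-+ (suc n) G K) ⟩
    ∑ (suc n) (λ j → G j + K j)                                    ≡⟨ ∑-cong (suc n) recombine ⟩
    ∑ (suc n) (λ j → S₂ (suc n) (suc j) * (suc j ! * (x C suc j)))  ≡⟨ sym (∑-uncons (suc n) _) ⟩
    ∑ (suc (suc n)) (λ j → S₂ (suc n) j * (j ! * (x C j)))          ∎
    where
    open ≡-Reasoning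
    F G H K : ℕ → ℕ
    F j = S₂ n j * (j ! * (x C j))
    G j = S₂ n j * (suc j ! * (x C suc j))
    H j = j * S₂ n j * (j ! * (x C j))
    K j = suc j * S₂ n (suc j) * (suc j ! * (x C suc j))
    absorb : ∀ j → x * F j ≡ G j + H j
    absorb j = begin
      x * (S₂ n j * (j ! * (x C j)))                               ≡⟨ move-x x (S₂ n j) (j !) (x C j) ⟩
      S₂ n j * (j ! * (x * (x C j)))                               ≡⟨ cong (λ c → S₂ n j * (j ! * c)) (n*nCk≡[1+k]*nC[1+k]+k*nCk x j) ⟩
      S₂ n j * (j ! * (suc j * (x C suc j) + j * (x C j)))         ≡⟨ expand (S₂ n j) (j !) j (x C suc j) (x C j) ⟩
      G j + H j                                                    ∎
      where
      move-x : ∀ x s f c → x * (s * (f * c)) ≡ s * (f * (x * c))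
      move-x = solve-∀
      expand : ∀ s f j c₁ c₀ → s * (f * (suc j * c₁ + j * c₀)) ≡ s * ((f + j * f) * c₁) + j * s * (f * c₀)
      expand = solve-∀
    ∑H≡∑K : ∑ (suc n) H ≡ ∑ (suc n) K
    ∑H≡∑K = begin
      ∑ (suc n) H      ≡⟨ ∑-uncons n H ⟩
      ∑ n K            ≡⟨ sym (ℕ.+-identityʳ (∑ n K)) ⟩
      ∑ n K + 0        ≡⟨ cong (∑ n K +_) (sym Kn≡0) ⟩
      ∑ (suc n) K      ∎
      where
      Kn≡0 : K n ≡ 0
      Kn≡0 = begin
        suc n * S₂ n (suc n) * _   ≡⟨ cong (λ s → suc n * s * (suc n ! * (x C suc n))) (n<k⇒S₂≡0 (ℕ.n<1+n n)) ⟩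
        suc n * 0 * _              ≡⟨ cong (_* (suc n ! * (x C suc n))) (ℕ.*-zeroʳ (suc n)) ⟩
        0                          ∎
    recombine : ∀ j → G j + K j ≡ S₂ (suc n) (suc j) * (suc j ! * (x C suc j))
    recombine j = factor (S₂ n j) (S₂ n (suc j)) j (suc j ! * (x C suc j))
      where
      factor : ∀ s s₁ j c → s * c + suc j * s₁ * c ≡ (suc j * s₁ + s) * c
      factor = solve-∀

  private
    RowIdentity : ℕ → Set
    RowIdentity n = ∀ k → ∑ (suc n) (λ l → (n C l) * S₂ l k) ≡ S₂ (suc n) (suc k)

    row-shift : ∀ n → RowIdentity n → ∀ k → S₂ 0 k + ∑ (suc n) (λ l → (n C suc l) * S₂ (suc l) k) ≡ S₂ (suc n) (suc k)
    row-shift n row k = begin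
      S₂ 0 k + ∑ (suc n) (λ l → (n C suc l) * S₂ (suc l) k)
        ≡⟨ cong (_+ ∑ (suc n) (λ l → (n C suc l) * S₂ (suc l) k)) (sym (ℕ.*-identityˡ (S₂ 0 k))) ⟩
      1 * S₂ 0 k + ∑ (suc n) (λ l → (n C suc l) * S₂ (suc l) k)   ≡⟨ sym (∑-uncons (suc n) (λ l → (n C l) * S₂ l k)) ⟩
      ∑ (suc n) (λ l → (n C l) * S₂ l k) + (n C suc n) * S₂ (suc n) k
        ≡⟨ cong (λ c → ∑ (suc n) (λ l → (n C l) * S₂ l k) + c * S₂ (suc n) k) (nC[1+n]≡0 n) ⟩
      ∑ (suc n) (λ l → (n C l) * S₂ l k) + 0                      ≡⟨ ℕ.+-identityʳ _ ⟩
      ∑ (suc n) (λ l → (n C l) * S₂ l k)                          ≡⟨ row k ⟩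
      S₂ (suc n) (suc k)                                          ∎
      where open ≡-Reasoning

    row-step : ∀ n → RowIdentity n → ∀ k →
               ∑ (suc n) (λ l → (n C l) * S₂ (suc l) k) + S₂ (suc n) (suc k) ≡ S₂ (suc (suc n)) (suc k)
    row-step n row zero    = begin
      ∑ (suc n) (λ l → (n C l) * 0) + S₂ (suc n) 1   ≡⟨ cong (_+ S₂ (suc n) 1) (∑-vanish (suc n) (λ l _ → ℕ.*-zeroʳ (n C l))) ⟩
      S₂ (suc n) 1                                   ≡⟨ sym (trans (ℕ.+-identityʳ _) (ℕ.*-identityˡ _)) ⟩
      S₂ (suc (suc n)) 1                             ∎
      where open ≡-Reasoning
    row-step n row (suc k) = begin
      ∑ (suc n) (λ l → (n C l) * (suc k * S₂ l (suc k) + S₂ l k)) + S₂ (suc n) (suc (suc k))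
        ≡⟨ cong (_+ S₂ (suc n) (suc (suc k))) (trans (∑-cong (suc n) (λ l → distribute (n C l) (suc k) (S₂ l (suc k)) (S₂ l k)))
                                                       (∑-distrib-+ (suc n) _ _)) ⟩
      ∑ (suc n) (λ l → suc k * ((n C l) * S₂ l (suc k))) + ∑ (suc n) (λ l → (n C l) * S₂ l k) + S₂ (suc n) (suc (suc k))
        ≡⟨ cong₂ (λ a b → a + b + S₂ (suc n) (suc (suc k)))
                 (trans (sym (*-distribˡ-∑ (suc n) (suc k) _)) (cong (suc k *_) (row (suc k))))
                 (row k) ⟩
      suc k * S₂ (suc n) (suc (suc k)) + S₂ (suc n) (suc k) + S₂ (suc n) (suc (suc k))
        ≡⟨ collect (suc k) (S₂ (suc n) (suc (suc k))) (S₂ (suc n) (suc k)) ⟩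
      S₂ (suc (suc n)) (suc (suc k))
        ∎
      where
      open ≡-Reasoning
      distribute : ∀ c k s₁ s₀ → c * (k * s₁ + s₀) ≡ k * (c * s₁) + c * s₀
      distribute = solve-∀
      collect : ∀ k a b → k * a + b + a ≡ suc k * a + b
      collect = solve-∀

  ∑C*S₂≡S₂ : ∀ n k → ∑ (suc n) (λ l → (n C l) * S₂ l k) ≡ S₂ (suc n) (suc k)
  ∑C*S₂≡S₂ zero    k = trans (ℕ.+-identityʳ (S₂ 0 k)) (sym (cong (_+ S₂ 0 k) (ℕ.*-zeroʳ (suc k))))
  ∑C*S₂≡S₂ (suc n) k = begin
    ∑ (suc (suc n)) (λ l → (suc n C l) * S₂ l k)                        ≡⟨ ∑-uncons (suc n) _ ⟩
    1 * S₂ 0 k + ∑ (suc n) (λ l → (suc n C suc l) * S₂ (suc l) k)       ≡⟨ cong₂ _+_ (ℕ.*-identityˡ (S₂ 0 k)) pascal-split ⟩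
    S₂ 0 k + (A + ∑ (suc n) (λ l → (n C suc l) * S₂ (suc l) k))         ≡⟨ +-CS.x∙yz≈y∙xz (S₂ 0 k) A _ ⟩
    A + (S₂ 0 k + ∑ (suc n) (λ l → (n C suc l) * S₂ (suc l) k))         ≡⟨ cong (A +_) (row-shift n (∑C*S₂≡S₂ n) k) ⟩
    A + S₂ (suc n) (suc k)                                              ≡⟨ row-step n (∑C*S₂≡S₂ n) k ⟩
    S₂ (suc (suc n)) (suc k)                                            ∎
    where
    open ≡-Reasoning
    A = ∑ (suc n) (λ l → (n C l) * S₂ (suc l) k)
    pascal-split : ∑ (suc n) (λ l → (suc n C suc l) * S₂ (suc l) k) ≡ A + ∑ (suc n) (λ l → (n C suc l) * S₂ (suc l) k)
    pascal-split = trans (∑-cong (suc n) (λ l → trans (cong (_* S₂ (suc l) k) (pascal n l))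
                                                      (ℕ.*-distribʳ-+ (S₂ (suc l) k) (n C l) (n C suc l))))
                         (∑-distrib-+ (suc n) _ _)

  ∑C[1+n]*S₂≡[1+j]*S₂ : ∀ n j → ∑ (suc n) (λ l → (suc n C l) * S₂ l j) ≡ suc j * S₂ (suc n) (suc j)
  ∑C[1+n]*S₂≡[1+j]*S₂ n j = ℕ.+-cancelʳ-≡ (S₂ (suc n) j) _ _ (begin
    ∑ (suc n) (λ l → (suc n C l) * S₂ l j) + S₂ (suc n) j
      ≡⟨ cong (∑ (suc n) (λ l → (suc n C l) * S₂ l j) +_)
              (sym (trans (cong (_* S₂ (suc n) j) (nCn≡1 (suc n))) (ℕ.*-identityˡ _))) ⟩
    ∑ (suc (suc n)) (λ l → (suc n C l) * S₂ l j)
      ≡⟨ ∑C*S₂≡S₂ (suc n) j ⟩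
    suc j * S₂ (suc n) (suc j) + S₂ (suc n) j
      ∎)
    where open ≡-Reasoning

  ∑C[1+n]*surj : ∀ n j → ∑ (suc n) (λ l → (suc n C l) * surj l j) ≡ suc j * (surj n (suc j) + surj n j)
  ∑C[1+n]*surj n j = begin
    ∑ (suc n) (λ l → (suc n C l) * (j ! * S₂ l j))    ≡⟨ ∑-cong (suc n) (λ l → *-CS.x∙yz≈y∙xz (suc n C l) (j !) (S₂ l j)) ⟩
    ∑ (suc n) (λ l → j ! * ((suc n C l) * S₂ l j))    ≡⟨ sym (*-distribˡ-∑ (suc n) (j !) _) ⟩
    j ! * ∑ (suc n) (λ l → (suc n C l) * S₂ l j)      ≡⟨ cong (j ! *_) (∑C[1+n]*S₂≡[1+j]*S₂ n j) ⟩
    j ! * (suc j * (suc j * S₂ n (suc j) + S₂ n j))   ≡⟨ factor (j !) j (S₂ n (suc j)) (S₂ n j) ⟩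
    suc j * (surj n (suc j) + surj n j)               ∎
    where
    open ≡-Reasoning
    factor : ∀ f j a b → f * (suc j * (suc j * a + b)) ≡ suc j * ((f + j * f) * a + f * b)
    factor = solve-∀

module SurjModPrime where

  open import Data.Nat using (ℕ; suc; _+_; _*_; _^_; _<_; _≤_; s≤s; z≤n; _!)
  import Data.Nat.Properties as ℕ
  open import Data.Nat.Combinatorics using (_C_; nCn≡1; k>n⇒nCk≡0)
  open import Data.Nat.Divisibility using (_∣_; ∣n⇒∣m*n; ∣m+n∣m⇒∣n; ∣1⇒≡1)
  open import Data.Nat.Primality using (Prime; ¬prime[1])
  open import Relation.Nullary using (¬_)
  open FiniteSum ℕ.+-*-isCommutativeSemiring
  open Congruence
  open Binomial
  open PowerSum
  open Stirling

  powerSum≡∑S₂ : ∀ m n → powerSum m n ≡ ∑ (suc n) (λ j → S₂ n j * (j ! * (m C suc j)))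
  powerSum≡∑S₂ m n = begin
    ∑ m (λ i → i ^ n)                                        ≡⟨ ∑-cong m (λ i → ^≡∑S₂ i n) ⟩
    ∑ m (λ i → ∑ (suc n) (λ j → S₂ n j * (j ! * (i C j))))   ≡⟨ ∑-comm m (suc n) _ ⟩
    ∑ (suc n) (λ j → ∑ m (λ i → S₂ n j * (j ! * (i C j))))   ≡⟨ ∑-cong (suc n) hockey ⟩
    ∑ (suc n) (λ j → S₂ n j * (j ! * (m C suc j)))           ∎
    where
    open ≡-Reasoning
    hockey : ∀ j → ∑ m (λ i → S₂ n j * (j ! * (i C j))) ≡ S₂ n j * (j ! * (m C suc j))
    hockey j = begin
      ∑ m (λ i → S₂ n j * (j ! * (i C j)))   ≡⟨ sym (*-distribˡ-∑ m (S₂ n j) _) ⟩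
      S₂ n j * ∑ m (λ i → j ! * (i C j))     ≡⟨ cong (S₂ n j *_) (sym (*-distribˡ-∑ m (j !) _)) ⟩
      S₂ n j * (j ! * ∑ m (λ i → i C j))     ≡⟨ cong (λ c → S₂ n j * (j ! * c)) (hockey-stick m j) ⟩
      S₂ n j * (j ! * (m C suc j))           ∎

  powerSum≈surj : ∀ {q} → Prime (suc q) → ∀ n → powerSum (suc q) n ≈ surj n q [mod suc q ]
  powerSum≈surj {q} pr n = begin
    powerSum (suc q) n   ≡⟨ powerSum≡∑S₂ (suc q) n ⟩
    ∑ (suc n) g          ≡⟨ ∑-support (suc n) (suc q) g beyond-n beyond-q ⟩
    ∑ q g + g q          ≈⟨ +-cong-≈ (∑-≈0 q p∣g) ≈-refl ⟩
    g q                  ≡⟨ g[q]≡surj ⟩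
    surj n q             ∎
    where
    open ≈-Reasoning (suc q)
    g : ℕ → ℕ
    g j = S₂ n j * (j ! * (suc q C suc j))
    beyond-n : ∀ j → suc n ≤ j → g j ≡ 0
    beyond-n j n<j = cong (_* (j ! * (suc q C suc j))) (n<k⇒S₂≡0 n<j)
    beyond-q : ∀ j → suc q ≤ j → g j ≡ 0
    beyond-q j q<j = trans (cong (λ c → S₂ n j * (j ! * c)) (k>n⇒nCk≡0 (s≤s q<j)))
                           (trans (cong (S₂ n j *_) (ℕ.*-zeroʳ (j !))) (ℕ.*-zeroʳ (S₂ n j)))
    p∣g : ∀ j → j < q → suc q ∣ g j
    p∣g j j<q = ∣n⇒∣m*n (S₂ n j) (∣n⇒∣m*n (j !) (prime∣pCk pr (s≤s z≤n) (s≤s j<q)))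
    g[q]≡surj : g q ≡ surj n q
    g[q]≡surj = trans (cong (λ c → S₂ n q * (q ! * c)) (nCn≡1 (suc q)))
                      (trans (cong (S₂ n q *_) (ℕ.*-identityʳ (q !))) (ℕ.*-comm (S₂ n q) (q !)))

  prime∣surj : ∀ {q} → Prime (suc q) → ∀ {n} → ¬ (q ∣ n) → suc q ∣ surj n q
  prime∣surj pr {n} q∤n = ≈0⇒∣ (≈-trans (≈-sym (powerSum≈surj pr n)) (∣⇒≈0 (∤⇒prime∣powerSum pr q∤n)))

  prime∤surj : ∀ {q} → Prime (suc q) → ∀ {n} → 0 < n → q ∣ n → ¬ (suc q ∣ surj n q)
  prime∤surj {q} pr {n} 0<n q∣n p∣surj = ¬prime[1] (subst Prime (∣1⇒≡1 p∣1) pr)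
    where
    p∣1 : suc q ∣ 1
    p∣1 = ∣m+n∣m⇒∣n (≈0⇒∣ (powerSum+1≈0 pr 0<n q∣n)) (≈0⇒∣ (≈-trans (powerSum≈surj pr n) (∣⇒≈0 p∣surj)))

module StirlingParity where

  open import Data.Nat using (ℕ; zero; suc; _+_; _*_)
  import Data.Nat.Properties as ℕ
  open import Data.Nat.Divisibility using (_∣_; divides)
  open import Data.Nat.Tactic.RingSolver using (solve-∀; solve)
  open import Data.List using (_∷_; [])
  open import Data.Product using (Σ; _×_; _,_; proj₁; proj₂)
  open Stirling

  S₂[1+n,1]≡1 : ∀ n → S₂ (suc n) 1 ≡ 1
  S₂[1+n,1]≡1 zero    = refl
  S₂[1+n,1]≡1 (suc n) = trans (ℕ.+-identityʳ _) (trans (ℕ.+-identityʳ _) (S₂[1+n,1]≡1 n))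

  S₂[2+n,2]-odd : ∀ n → Σ ℕ λ t → S₂ (2 + n) 2 ≡ 1 + 2 * t
  S₂[2+n,2]-odd zero    = 0 , refl
  S₂[2+n,2]-odd (suc n) with S₂[2+n,2]-odd n
  ... | t , eq = 1 + 2 * t , (begin
    2 * S₂ (2 + n) 2 + S₂ (2 + n) 1   ≡⟨ cong₂ (λ a b → 2 * a + b) eq (S₂[1+n,1]≡1 (suc n)) ⟩
    2 * (1 + 2 * t) + 1               ≡⟨ solve (t ∷ []) ⟩
    1 + 2 * (1 + 2 * t)               ∎)
    where open ≡-Reasoning

  S₂[_,3]-parity : ∀ m → (Σ ℕ λ t → S₂ (2 + 2 * m) 3 ≡ 2 * t) × (Σ ℕ λ t → S₂ (3 + 2 * m) 3 ≡ 1 + 2 * t)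
  S₂[ zero  ,3]-parity = (0 , refl) , (0 , refl)
  S₂[ suc m ,3]-parity with S₂[ m ,3]-parity
  ... | (t , even) , (t′ , odd) = (a , S₂[2m+4,3]≡2a) , (3 * a + v , S₂[2m+5,3]≡1+2b)
    where
    open ≡-Reasoning
    2+2[1+m]≡1+[3+2m] : ∀ m → 2 + 2 * suc m ≡ suc (3 + 2 * m)
    2+2[1+m]≡1+[3+2m] = solve-∀
    3+2[1+m]≡1+[2+2[1+m]] : ∀ m → 3 + 2 * suc m ≡ suc (2 + 2 * suc m)
    3+2[1+m]≡1+[2+2[1+m]] = solve-∀
    regroup₁ : ∀ t u → 3 * (1 + 2 * t) + (1 + 2 * u) ≡ 2 * (2 + 3 * t + u)
    regroup₁ = solve-∀
    regroup₂ : ∀ a v → 3 * (2 * a) + (1 + 2 * v) ≡ 1 + 2 * (3 * a + v)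
    regroup₂ = solve-∀
    u = proj₁ (S₂[2+n,2]-odd (1 + 2 * m))
    v = proj₁ (S₂[2+n,2]-odd (2 * suc m))
    a = 2 + 3 * t′ + u
    S₂[2m+4,3]≡2a : S₂ (2 + 2 * suc m) 3 ≡ 2 * a
    S₂[2m+4,3]≡2a = begin
      S₂ (2 + 2 * suc m) 3                          ≡⟨ cong (λ k → S₂ k 3) (2+2[1+m]≡1+[3+2m] m) ⟩
      3 * S₂ (3 + 2 * m) 3 + S₂ (3 + 2 * m) 2       ≡⟨ cong₂ (λ x y → 3 * x + y) odd (proj₂ (S₂[2+n,2]-odd (1 + 2 * m))) ⟩
      3 * (1 + 2 * t′) + (1 + 2 * u)                ≡⟨ regroup₁ t′ u ⟩
      2 * a                                         ∎
    S₂[2m+5,3]≡1+2b : S₂ (3 + 2 * suc m) 3 ≡ 1 + 2 * (3 * a + v)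
    S₂[2m+5,3]≡1+2b = begin
      S₂ (3 + 2 * suc m) 3                              ≡⟨ cong (λ k → S₂ k 3) (3+2[1+m]≡1+[2+2[1+m]] m) ⟩
      3 * S₂ (2 + 2 * suc m) 3 + S₂ (2 + 2 * suc m) 2   ≡⟨ cong₂ (λ x y → 3 * x + y) S₂[2m+4,3]≡2a (proj₂ (S₂[2+n,2]-odd (2 * suc m))) ⟩
      3 * (2 * a) + (1 + 2 * v)                         ≡⟨ regroup₂ a v ⟩
      1 + 2 * (3 * a + v)                               ∎

  4∣surj[2m,3] : ∀ m → 4 ∣ surj (m * 2) 3
  4∣surj[2m,3] zero    = divides 0 refl
  4∣surj[2m,3] (suc m) with proj₁ S₂[ m ,3]-parity
  ... | t , even = divides (3 * t) (begin
    6 * S₂ (suc m * 2) 3     ≡⟨ cong (λ k → 6 * S₂ k 3) (index m) ⟩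
    6 * S₂ (2 + 2 * m) 3     ≡⟨ cong (6 *_) even ⟩
    6 * (2 * t)              ≡⟨ solve (t ∷ []) ⟩
    3 * t * 4                ∎)
    where
    open ≡-Reasoning
    index : ∀ m → suc m * 2 ≡ 2 + 2 * m
    index = solve-∀

  surj[2m+3,3]≡6*odd : ∀ m → Σ ℕ λ t → surj (3 + 2 * m) 3 ≡ 6 * (1 + 2 * t)
  surj[2m+3,3]≡6*odd m with proj₂ S₂[ m ,3]-parity
  ... | t , odd = t , cong (6 *_) odd

module CompositeFactorial where

  open import Data.Nat using (ℕ; suc; _*_; _<_; _≤_; s≤s; z≤n; _!; nonTrivial⇒n>1)
  import Data.Nat.Properties as ℕ
  open import Data.Nat.Divisibility using (_∣_; divides; ∣-trans; m∣m*n; *-monoʳ-∣; m≤n⇒m!∣n!)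
  open import Data.Nat.Primality using (Composite; composite)
  open import Relation.Binary.Definitions using (tri<; tri≈; tri>)

  m<n≤o⇒m*n∣o! : ∀ {m n o} → 0 < m → m < n → n ≤ o → m * n ∣ o !
  m<n≤o⇒m*n∣o! {suc m} {suc n} _ m<n n≤o = ∣-trans m*n∣n! (m≤n⇒m!∣n! n≤o)
    where
    m*n∣n! : suc m * suc n ∣ suc n !
    m*n∣n! = subst (_∣ suc n !) (ℕ.*-comm (suc n) (suc m))
                   (*-monoʳ-∣ (suc n) (∣-trans (m∣m*n (m !)) (m≤n⇒m!∣n! (ℕ.≤-pred m<n))))

  square∣factorial : ∀ {n} d → 2 < d → suc n ≡ d * d → suc n ∣ n !
  square∣factorial {n} d@(suc _) 2<d n+1≡d*d =
    subst (_∣ n !) (sym n+1≡d*d) (∣-trans (*-monoʳ-∣ d (m∣m*n 2)) (m<n≤o⇒m*n∣o! (s≤s z≤n) d<2d 2d≤n))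
    where
    d<2d : d < d * 2
    d<2d = ℕ.m<m*n d 2 (s≤s (s≤s z≤n))
    2d≤n : d * 2 ≤ n
    2d≤n = ℕ.≤-pred (subst (d * 2 <_) (sym n+1≡d*d) (ℕ.*-monoʳ-< d 2<d))

  composite∣factorial : ∀ {n} → Composite (suc n) → suc n ≢ 4 → suc n ∣ n !
  composite∣factorial {n} (composite {d} d<n+1 (divides (suc e) n+1≡ed)) n+1≢4 with ℕ.<-cmp d (suc e)
  ... | tri< d<e _ _ = subst (_∣ n !) (trans (ℕ.*-comm d (suc e)) (sym n+1≡ed))
                             (m<n≤o⇒m*n∣o! (ℕ.<-trans (s≤s z≤n) (nonTrivial⇒n>1 d)) d<e (ℕ.≤-pred e<n+1))
    where
    e<n+1 : suc e < suc n
    e<n+1 = subst (suc e <_) (sym n+1≡ed) (ℕ.m<m*n (suc e) d (nonTrivial⇒n>1 d))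
  ... | tri> _ _ e<d = subst (_∣ n !) (sym n+1≡ed) (m<n≤o⇒m*n∣o! (s≤s z≤n) e<d (ℕ.≤-pred d<n+1))
  ... | tri≈ _ refl _ = square∣factorial (suc e) 2<d (trans n+1≡ed (ℕ.*-comm (suc e) (suc e)))
    where
    2<d : 2 < suc e
    2<d = ℕ.≤∧≢⇒< (nonTrivial⇒n>1 (suc e)) (λ 2≡d → n+1≢4 (trans n+1≡ed (cong (λ x → x * x) (sym 2≡d))))

module SurjTerms where

  open import Data.Nat using (ℕ; zero; suc; _≟_)
  open import Data.Nat.Divisibility using (_∣_; _∣?_; divides; ∣-trans; m∣m*n; 1∣_)
  open import Data.Nat.Primality using (Prime; prime?; ¬prime⇒composite)
  open import Relation.Nullary using (¬_; yes; no)
  open Stirling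
  open SurjModPrime using (prime∣surj)
  open StirlingParity using (4∣surj[2m,3])
  open CompositeFactorial

  data SurjTerm (n j : ℕ) : Set where
    integral    : suc j ∣ surj n j → SurjTerm n j
    von-staudt  : Prime (suc j) → j ∣ n → SurjTerm n j
    exceptional : j ≡ 3 → ¬ (2 ∣ n) → SurjTerm n j

  classify : ∀ n j → SurjTerm n j
  classify n zero = integral (1∣ _)
  classify n (suc j) with prime? (suc (suc j))
  ... | yes pr with suc j ∣? n
  ...   | yes j∣n = von-staudt pr j∣n
  ...   | no  j∤n = integral (prime∣surj pr j∤n)
  classify n (suc j) | no ¬pr with suc (suc j) ≟ 4
  ...   | no  ≢4  = integral (∣-trans (composite∣factorial (¬prime⇒composite ¬pr) ≢4) (m∣m*n (S₂ n (suc j))))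
  ...   | yes refl with 2 ∣? n
  ...     | yes (divides m refl) = integral (4∣surj[2m,3] m)
  ...     | no  odd              = exceptional refl odd

module Rationals where

  open import Data.Nat as ℕ using (ℕ; suc; NonZero; _!)
  import Data.Nat.Properties as ℕ
  open import Data.Integer as ℤ using (ℤ; +_)
  import Data.Integer.Properties as ℤ
  open import Data.Integer.Tactic.RingSolver using (solve-∀)
  open import Data.Rational using (ℚ; _/_; 1ℚ; fromℚᵘ; _+_; _*_; -_)
  open import Data.Rational.Properties
    using (fromℚᵘ-cong; toℚᵘ-injective; toℚᵘ-fromℚᵘ; toℚᵘ-homo-+; toℚᵘ-homo-*; toℚᵘ-homo‿-)
  open import Data.Rational.Unnormalised as ℚᵘ using (mkℚᵘ; *≡*)
  import Data.Rational.Unnormalised.Properties as ℚᵘ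
  import Data.Rational.Properties as ℚ
  import Tactic.RingSolver.Core.AlmostCommutativeRing as ACR
  open import Data.Maybe using (nothing)
  open import Level using (0ℓ)

  fromℚᵘ-homo-+ : ∀ x y → fromℚᵘ (x ℚᵘ.+ y) ≡ fromℚᵘ x + fromℚᵘ y
  fromℚᵘ-homo-+ x y = toℚᵘ-injective (ℚᵘ.≃-trans (toℚᵘ-fromℚᵘ (x ℚᵘ.+ y))
    (ℚᵘ.≃-trans (ℚᵘ.+-cong (ℚᵘ.≃-sym (toℚᵘ-fromℚᵘ x)) (ℚᵘ.≃-sym (toℚᵘ-fromℚᵘ y)))
                (ℚᵘ.≃-sym (toℚᵘ-homo-+ (fromℚᵘ x) (fromℚᵘ y)))))

  fromℚᵘ-homo-* : ∀ x y → fromℚᵘ (x ℚᵘ.* y) ≡ fromℚᵘ x * fromℚᵘ y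
  fromℚᵘ-homo-* x y = toℚᵘ-injective (ℚᵘ.≃-trans (toℚᵘ-fromℚᵘ (x ℚᵘ.* y))
    (ℚᵘ.≃-trans (ℚᵘ.*-cong (ℚᵘ.≃-sym (toℚᵘ-fromℚᵘ x)) (ℚᵘ.≃-sym (toℚᵘ-fromℚᵘ y)))
                (ℚᵘ.≃-sym (toℚᵘ-homo-* (fromℚᵘ x) (fromℚᵘ y)))))

  fromℚᵘ-homo‿- : ∀ x → fromℚᵘ (ℚᵘ.- x) ≡ - fromℚᵘ x
  fromℚᵘ-homo‿- x = toℚᵘ-injective (ℚᵘ.≃-trans (toℚᵘ-fromℚᵘ (ℚᵘ.- x))
    (ℚᵘ.≃-trans (ℚᵘ.-‿cong (ℚᵘ.≃-sym (toℚᵘ-fromℚᵘ x))) (ℚᵘ.≃-sym (toℚᵘ-homo‿- (fromℚᵘ x)))))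

  ι : ℤ → ℚ
  ι a = a / 1

  ι-+ : ∀ a b → ι (a ℤ.+ b) ≡ ι a + ι b
  ι-+ a b = trans (fromℚᵘ-cong {mkℚᵘ (a ℤ.+ b) 0} {mkℚᵘ a 0 ℚᵘ.+ mkℚᵘ b 0} (*≡* (identity a b)))
                  (fromℚᵘ-homo-+ (mkℚᵘ a 0) (mkℚᵘ b 0))
    where
    identity : ∀ a b → (a ℤ.+ b) ℤ.* + 1 ≡ (a ℤ.* + 1 ℤ.+ b ℤ.* + 1) ℤ.* + 1
    identity = solve-∀

  ι-* : ∀ a b → ι (a ℤ.* b) ≡ ι a * ι b
  ι-* a b = trans (fromℚᵘ-cong {mkℚᵘ (a ℤ.* b) 0} {mkℚᵘ a 0 ℚᵘ.* mkℚᵘ b 0} (*≡* refl))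
                  (fromℚᵘ-homo-* (mkℚᵘ a 0) (mkℚᵘ b 0))

  ι-neg : ∀ a → ι (ℤ.- a) ≡ - ι a
  ι-neg a = fromℚᵘ-homo‿- (mkℚᵘ a 0)

  ιₙ : ℕ → ℚ
  ιₙ n = ι (+ n)

  ιₙ-+ : ∀ m n → ιₙ (m ℕ.+ n) ≡ ιₙ m + ιₙ n
  ιₙ-+ m n = trans (cong ι (ℤ.pos-+ m n)) (ι-+ (+ m) (+ n))

  ιₙ-* : ∀ m n → ιₙ (m ℕ.* n) ≡ ιₙ m * ιₙ n
  ιₙ-* m n = trans (cong ι (ℤ.pos-* m n)) (ι-* (+ m) (+ n))

  1/ₙ_ : (d : ℕ) → .{{NonZero d}} → ℚ
  1/ₙ d = + 1 / d

  ιₙ*1/ₙ≡1 : ∀ d .{{_ : NonZero d}} → ιₙ d * 1/ₙ d ≡ 1ℚ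
  ιₙ*1/ₙ≡1 (suc d) = trans (sym (fromℚᵘ-homo-* (mkℚᵘ (+ suc d) 0) (mkℚᵘ (+ 1) d)))
    (fromℚᵘ-cong {mkℚᵘ (+ suc d) 0 ℚᵘ.* mkℚᵘ (+ 1) d} {mkℚᵘ (+ 1) 0} (*≡* (identity d)))
    where
    identity : ∀ d → (+ suc d ℤ.* + 1) ℤ.* + 1 ≡ + 1 ℤ.* + suc (d ℕ.+ 0)
    identity d rewrite ℕ.+-identityʳ d = unit (+ suc d)
      where
      unit : ∀ n → (n ℤ.* + 1) ℤ.* + 1 ≡ + 1 ℤ.* n
      unit = solve-∀

  /≡ι*1/ₙ : ∀ a d .{{_ : NonZero d}} → a / d ≡ ι a * 1/ₙ d
  /≡ι*1/ₙ a (suc d) = trans (fromℚᵘ-cong {mkℚᵘ a d} {mkℚᵘ a 0 ℚᵘ.* mkℚᵘ (+ 1) d} (*≡* (identity a d)))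
                            (fromℚᵘ-homo-* (mkℚᵘ a 0) (mkℚᵘ (+ 1) d))
    where
    identity : ∀ a d → a ℤ.* + suc (d ℕ.+ 0) ≡ (a ℤ.* + 1) ℤ.* + suc d
    identity a d rewrite ℕ.+-identityʳ d = unit a (+ suc d)
      where
      unit : ∀ a e → a ℤ.* e ≡ (a ℤ.* + 1) ℤ.* e
      unit = solve-∀

  ιₙ*-cancelˡ : ∀ d .{{_ : NonZero d}} x y → ιₙ d * x ≡ ιₙ d * y → x ≡ y
  ιₙ*-cancelˡ d x y eq = begin
    x                        ≡⟨ sym (unit x) ⟩
    1/ₙ d * (ιₙ d * x)       ≡⟨ cong (1/ₙ d *_) eq ⟩
    1/ₙ d * (ιₙ d * y)       ≡⟨ unit y ⟩
    y                        ∎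
    where
    open ≡-Reasoning
    unit : ∀ z → 1/ₙ d * (ιₙ d * z) ≡ z
    unit z = begin
      1/ₙ d * (ιₙ d * z)     ≡⟨ sym (ℚ.*-assoc (1/ₙ d) (ιₙ d) z) ⟩
      1/ₙ d * ιₙ d * z       ≡⟨ cong (_* z) (trans (ℚ.*-comm (1/ₙ d) (ιₙ d)) (ιₙ*1/ₙ≡1 d)) ⟩
      1ℚ * z                 ≡⟨ ℚ.*-identityˡ z ⟩
      z                      ∎

  ℚ-ring : ACR.AlmostCommutativeRing 0ℓ 0ℓ
  ℚ-ring = ACR.fromCommutativeRing ℚ.+-*-commutativeRing (λ _ → nothing)

  1/[_!] : ℕ → ℚ
  1/[ j !] = 1/ₙ (j !)
    where instance _ = j ℕ.!≢0

  ιₙ[n!]*1/[n!]≡1 : ∀ n → ιₙ (n !) * 1/[ n !] ≡ 1ℚ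
  ιₙ[n!]*1/[n!]≡1 n = ιₙ*1/ₙ≡1 (n !)
    where instance _ = n ℕ.!≢0

module Worpitzky where

  open import Data.Nat as ℕ using (ℕ; zero; suc; _<_; _≤_)
  import Data.Nat.Properties as ℕ
  open import Data.Nat.Combinatorics using (_C_)
  open import Data.Rational using (ℚ; 0ℚ; 1ℚ; _+_; _*_; -_)
  import Data.Rational.Properties as ℚ
  open import Algebra.Structures using (IsCommutativeRing)
  open import Algebra.Properties.AbelianGroup ℚ.+-0-abelianGroup using (xyx⁻¹≈y)
  open import Tactic.RingSolver using (solve-∀)
  open Rationals
  open Stirling using (surj; n<k⇒surj≡0; ∑C[1+n]*surj)
  open FiniteSum (IsCommutativeRing.isCommutativeSemiring ℚ.+-*-isCommutativeRing)
  module ℕ∑ = FiniteSum ℕ.+-*-isCommutativeSemiring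
  open ≡-Reasoning

  ιₙ-∑ : ∀ n f → ιₙ (ℕ∑.∑ n f) ≡ ∑ n (λ i → ιₙ (f i))
  ιₙ-∑ zero    f = refl
  ιₙ-∑ (suc n) f = trans (ιₙ-+ (ℕ∑.∑ n f) (f n)) (cong (_+ ιₙ (f n)) (ιₙ-∑ n f))

  sign : ℕ → ℚ
  sign zero    = 1ℚ
  sign (suc j) = - sign j

  βterm : ℕ → ℕ → ℚ
  βterm n j = sign j * ιₙ (surj n j) * 1/ₙ (suc j)

  β : ℕ → ℚ
  β n = ∑ (suc n) (βterm n)

  βterm-vanish : ∀ {n j} → n < j → βterm n j ≡ 0ℚ
  βterm-vanish {n} {j} n<j = begin
    sign j * ιₙ (surj n j) * 1/ₙ (suc j)   ≡⟨ cong (λ s → sign j * ιₙ s * 1/ₙ (suc j)) (n<k⇒surj≡0 n<j) ⟩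
    sign j * 0ℚ * 1/ₙ (suc j)              ≡⟨ cong (_* 1/ₙ (suc j)) (ℚ.*-zeroʳ (sign j)) ⟩
    0ℚ * 1/ₙ (suc j)                       ≡⟨ ℚ.*-zeroˡ (1/ₙ (suc j)) ⟩
    0ℚ                                     ∎

  β≡∑-wider : ∀ {l n} → l ≤ n → β l ≡ ∑ (suc n) (βterm l)
  β≡∑-wider {l} {n} l≤n = ∑-support (suc l) (suc n) (βterm l) (λ j l<j → βterm-vanish l<j)
                                       (λ j n<j → βterm-vanish (ℕ.≤-<-trans l≤n n<j))

  ∑C*βterm : ∀ n j → ∑ (suc n) (λ l → ιₙ (suc n C l) * βterm l j) ≡ sign j * ιₙ (surj n (suc j) ℕ.+ surj n j)
  ∑C*βterm n j = begin
    ∑ (suc n) (λ l → ιₙ (suc n C l) * βterm l j)                     ≡⟨ ∑-cong (suc n) pull-out ⟩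
    ∑ (suc n) (λ l → c * ιₙ ((suc n C l) ℕ.* surj l j))              ≡⟨ sym (*-distribˡ-∑ (suc n) c _) ⟩
    c * ∑ (suc n) (λ l → ιₙ ((suc n C l) ℕ.* surj l j))              ≡⟨ cong (c *_) (sym (ιₙ-∑ (suc n) _)) ⟩
    c * ιₙ (ℕ∑.∑ (suc n) (λ l → (suc n C l) ℕ.* surj l j))           ≡⟨ cong (λ x → c * ιₙ x) (∑C[1+n]*surj n j) ⟩
    c * ιₙ (suc j ℕ.* (surj n (suc j) ℕ.+ surj n j))                 ≡⟨ cong (c *_) (ιₙ-* (suc j) (surj n (suc j) ℕ.+ surj n j)) ⟩
    c * (ιₙ (suc j) * ιₙ (surj n (suc j) ℕ.+ surj n j))              ≡⟨ cancel (sign j) (1/ₙ (suc j)) (ιₙ (suc j)) _ ⟩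
    sign j * ιₙ (surj n (suc j) ℕ.+ surj n j) * (ιₙ (suc j) * 1/ₙ (suc j))
                                                                     ≡⟨ cong (sign j * ιₙ (surj n (suc j) ℕ.+ surj n j) *_) (ιₙ*1/ₙ≡1 (suc j)) ⟩
    sign j * ιₙ (surj n (suc j) ℕ.+ surj n j) * 1ℚ                   ≡⟨ ℚ.*-identityʳ _ ⟩
    sign j * ιₙ (surj n (suc j) ℕ.+ surj n j)                        ∎
    where
    c = sign j * 1/ₙ (suc j)
    rearrange : ∀ b s t i → b * (s * t * i) ≡ (s * i) * (b * t)
    rearrange = solve-∀ ℚ-ring
    cancel : ∀ s i c x → (s * i) * (c * x) ≡ s * x * (c * i)
    cancel = solve-∀ ℚ-ring
    pull-out : ∀ l → ιₙ (suc n C l) * βterm l j ≡ c * ιₙ ((suc n C l) ℕ.* surj l j)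
    pull-out l = trans (rearrange (ιₙ (suc n C l)) (sign j) (ιₙ (surj l j)) (1/ₙ (suc j)))
                       (cong (c *_) (sym (ιₙ-* (suc n C l) (surj l j))))

  ∑C*β≡0 : ∀ n → 0 < n → ∑ (suc n) (λ l → ιₙ (suc n C l) * β l) ≡ 0ℚ
  ∑C*β≡0 n@(suc _) _ = begin
    ∑ (suc n) (λ l → ιₙ (suc n C l) * β l)
      ≡⟨ ∑-cong-< (suc n) (λ l l<n → cong (ιₙ (suc n C l) *_) (β≡∑-wider (ℕ.≤-pred l<n))) ⟩
    ∑ (suc n) (λ l → ιₙ (suc n C l) * ∑ (suc n) (βterm l))
      ≡⟨ ∑-cong (suc n) (λ l → *-distribˡ-∑ (suc n) (ιₙ (suc n C l)) (βterm l)) ⟩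
    ∑ (suc n) (λ l → ∑ (suc n) (λ j → ιₙ (suc n C l) * βterm l j))
      ≡⟨ ∑-comm (suc n) (suc n) _ ⟩
    ∑ (suc n) (λ j → ∑ (suc n) (λ l → ιₙ (suc n C l) * βterm l j))
      ≡⟨ ∑-cong (suc n) (∑C*βterm n) ⟩
    ∑ (suc n) g
      ≡⟨ sym (trans (cong (∑ (suc n) g +_) w[1+n]≡0) (ℚ.+-identityʳ _)) ⟩
    ∑ (suc n) g + w (suc n)
      ≡⟨ ∑-telescope (suc n) g w telescoping ⟩
    w 0
      ≡⟨⟩
    0ℚ
      ∎
    where
    g w : ℕ → ℚ
    g j = sign j * ιₙ (surj n (suc j) ℕ.+ surj n j)
    w j = sign j * ιₙ (surj n j)
    w[1+n]≡0 : w (suc n) ≡ 0ℚ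
    w[1+n]≡0 = trans (cong (λ s → sign (suc n) * ιₙ s) (n<k⇒surj≡0 (ℕ.n<1+n n))) (ℚ.*-zeroʳ (sign (suc n)))
    cancel : ∀ s a b → s * (a + b) + (- s) * a ≡ s * b
    cancel s a b = begin
      s * (a + b) + (- s) * a      ≡⟨ cong₂ _+_ (ℚ.*-distribˡ-+ s a b) (sym (ℚ.neg-distribˡ-* s a)) ⟩
      s * a + s * b + - (s * a)    ≡⟨ xyx⁻¹≈y (s * a) (s * b) ⟩
      s * b                        ∎
    telescoping : ∀ j → g j + w (suc j) ≡ w j
    telescoping j = trans (cong (λ x → sign j * x + w (suc j)) (ιₙ-+ (surj n (suc j)) (surj n j)))
                          (cancel (sign j) (ιₙ (surj n (suc j))) (ιₙ (surj n j)))

module BernoulliNumbers where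

  open import Data.Nat as ℕ using (ℕ; zero; suc; _≤_; s≤s; z≤n; _!; _∸_)
  import Data.Nat.Properties as ℕ
  open import Data.Nat.Combinatorics using (_C_)
  open import Data.Rational using (ℚ; 0ℚ; 1ℚ; _+_; _*_; -_)
  import Data.Rational.Properties as ℚ
  open import Algebra.Structures using (IsCommutativeRing)
  open import Algebra.Bundles using (CommutativeRing)
  open import Algebra.Properties.Group ℚ.+-0-group using (inverseʳ-unique)
  open import Algebra.Properties.CommutativeSemigroup (CommutativeRing.*-commutativeSemigroup ℚ.+-*-commutativeRing)
    using (x∙yz≈y∙xz)
  open import Tactic.RingSolver using (solve-∀)
  open import Data.List using (_∷_; foldr; zipWith; map; applyUpTo; applyDownFrom; upTo)
  open import Data.List.Properties using (map-applyUpTo)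
  open import Defs using (E; invCoeffsRev; head0; B)
  open Rationals
  open Binomial using (nCk*[k!*[n∸k]!]≡n!)
  open Worpitzky using (β; ∑C*β≡0)
  open FiniteSum (IsCommutativeRing.isCommutativeSemiring ℚ.+-*-isCommutativeRing)
  open ≡-Reasoning

  ιₙ[nCk]*1/[n!]≡1/[k!]*1/[n∸k!] : ∀ {n k} → k ≤ n → ιₙ (n C k) * 1/[ n !] ≡ 1/[ k !] * 1/[ n ∸ k !]
  ιₙ[nCk]*1/[n!]≡1/[k!]*1/[n∸k!] {n} {k} k≤n = begin
    ιₙ (n C k) * 1/[ n !]
      ≡⟨ sym (trans (cong₂ (λ a b → ιₙ (n C k) * 1/[ n !] * a * b) (ιₙ[n!]*1/[n!]≡1 k) (ιₙ[n!]*1/[n!]≡1 (n ∸ k)))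
                    (trans (ℚ.*-identityʳ _) (ℚ.*-identityʳ _))) ⟩
    ιₙ (n C k) * 1/[ n !] * (ιₙ (k !) * 1/[ k !]) * (ιₙ ((n ∸ k) !) * 1/[ n ∸ k !])
      ≡⟨ regroup (ιₙ (n C k)) 1/[ n !] (ιₙ (k !)) 1/[ k !] (ιₙ ((n ∸ k) !)) 1/[ n ∸ k !] ⟩
    ιₙ (n C k) * (ιₙ (k !) * ιₙ ((n ∸ k) !)) * 1/[ n !] * (1/[ k !] * 1/[ n ∸ k !])
      ≡⟨ cong (λ x → x * 1/[ n !] * (1/[ k !] * 1/[ n ∸ k !])) n!-as-product ⟩
    ιₙ (n !) * 1/[ n !] * (1/[ k !] * 1/[ n ∸ k !])
      ≡⟨ cong (_* (1/[ k !] * 1/[ n ∸ k !])) (ιₙ[n!]*1/[n!]≡1 n) ⟩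
    1ℚ * (1/[ k !] * 1/[ n ∸ k !])
      ≡⟨ ℚ.*-identityˡ _ ⟩
    1/[ k !] * 1/[ n ∸ k !]
      ∎
    where
    regroup : ∀ c i a ia b ib → c * i * (a * ia) * (b * ib) ≡ c * (a * b) * i * (ia * ib)
    regroup = solve-∀ ℚ-ring
    n!-as-product : ιₙ (n C k) * (ιₙ (k !) * ιₙ ((n ∸ k) !)) ≡ ιₙ (n !)
    n!-as-product = begin
      ιₙ (n C k) * (ιₙ (k !) * ιₙ ((n ∸ k) !))  ≡⟨ cong (ιₙ (n C k) *_) (sym (ιₙ-* (k !) ((n ∸ k) !))) ⟩
      ιₙ (n C k) * ιₙ (k ! ℕ.* (n ∸ k) !)       ≡⟨ sym (ιₙ-* (n C k) _) ⟩
      ιₙ ((n C k) ℕ.* (k ! ℕ.* (n ∸ k) !))      ≡⟨ cong ιₙ (nCk*[k!*[n∸k]!]≡n! k≤n) ⟩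
      ιₙ (n !)                                  ∎

  γ : ℕ → ℚ
  γ j = β j * 1/[ j !]

  γ[1+n]≡-∑γE : ∀ n → γ (suc n) ≡ - ∑ (suc n) (λ j → γ j * E (suc (n ∸ j)))
  γ[1+n]≡-∑γE n = inverseʳ-unique (∑ (suc n) (λ j → γ j * E (suc (n ∸ j)))) (γ (suc n)) (begin
    ∑ (suc n) (λ j → γ j * E (suc (n ∸ j))) + γ (suc n)
      ≡⟨ cong₂ _+_ (∑-cong-< (suc n) (λ j j<n → sym (scaled-term j (ℕ.≤-pred j<n)))) (sym last-term) ⟩
    ∑ (suc (suc n)) (λ l → ιₙ (N C l) * β l * 1/[ N !])
      ≡⟨ ∑-cong (suc (suc n)) (λ l → ℚ.*-comm (ιₙ (N C l) * β l) 1/[ N !]) ⟩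
    ∑ (suc (suc n)) (λ l → 1/[ N !] * (ιₙ (N C l) * β l))
      ≡⟨ sym (*-distribˡ-∑ (suc (suc n)) 1/[ N !] _) ⟩
    1/[ N !] * ∑ (suc (suc n)) (λ l → ιₙ (N C l) * β l)
      ≡⟨ cong (1/[ N !] *_) (∑C*β≡0 (suc n) (s≤s z≤n)) ⟩
    1/[ N !] * 0ℚ
      ≡⟨ ℚ.*-zeroʳ 1/[ N !] ⟩
    0ℚ
      ∎)
    where
    N = suc (suc n)
    swap : ∀ c b i → c * b * i ≡ b * (c * i)
    swap = solve-∀ ℚ-ring
    scaled : ∀ {l} → l ≤ N → ιₙ (N C l) * β l * 1/[ N !] ≡ γ l * 1/[ N ∸ l !]
    scaled {l} l≤N = begin
      ιₙ (N C l) * β l * 1/[ N !]        ≡⟨ swap (ιₙ (N C l)) (β l) 1/[ N !] ⟩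
      β l * (ιₙ (N C l) * 1/[ N !])      ≡⟨ cong (β l *_) (ιₙ[nCk]*1/[n!]≡1/[k!]*1/[n∸k!] l≤N) ⟩
      β l * (1/[ l !] * 1/[ N ∸ l !])    ≡⟨ sym (ℚ.*-assoc (β l) 1/[ l !] 1/[ N ∸ l !]) ⟩
      γ l * 1/[ N ∸ l !]                 ∎
    scaled-term : ∀ j → j ≤ n → ιₙ (N C j) * β j * 1/[ N !] ≡ γ j * E (suc (n ∸ j))
    scaled-term j j≤n = trans (scaled (ℕ.m≤n⇒m≤1+n (ℕ.m≤n⇒m≤1+n j≤n)))
                              (cong (λ m → γ j * 1/[ m !]) (ℕ.+-∸-assoc 2 j≤n))
    last-term : ιₙ (N C suc n) * β (suc n) * 1/[ N !] ≡ γ (suc n)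
    last-term = trans (scaled (ℕ.n≤1+n (suc n)))
                      (trans (cong (λ m → γ (suc n) * 1/[ m !]) (ℕ.m+n∸n≡m 1 (suc n))) (ℚ.*-identityʳ (γ (suc n))))

  foldr-zipWith≡∑ : ∀ n (g f : ℕ → ℚ) →
    foldr _+_ 0ℚ (zipWith _*_ (applyDownFrom g (suc n)) (applyUpTo f (suc n))) ≡ ∑ (suc n) (λ j → g j * f (n ∸ j))
  foldr-zipWith≡∑ zero    g f = trans (ℚ.+-identityʳ (g 0 * f 0)) (sym (ℚ.+-identityˡ (g 0 * f 0)))
  foldr-zipWith≡∑ (suc n) g f = begin
    g (suc n) * f 0 + foldr _+_ 0ℚ (zipWith _*_ (applyDownFrom g (suc n)) (applyUpTo (λ i → f (suc i)) (suc n)))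
      ≡⟨ cong (g (suc n) * f 0 +_) (foldr-zipWith≡∑ n g (λ i → f (suc i))) ⟩
    g (suc n) * f 0 + ∑ (suc n) (λ j → g j * f (suc (n ∸ j)))
      ≡⟨ ℚ.+-comm (g (suc n) * f 0) _ ⟩
    ∑ (suc n) (λ j → g j * f (suc (n ∸ j))) + g (suc n) * f 0
      ≡⟨ cong₂ _+_ (∑-cong-< (suc n) (λ j j<n → cong (λ m → g j * f m) (sym (ℕ.+-∸-assoc 1 (ℕ.≤-pred j<n)))))
                   (cong (λ m → g (suc n) * f m) (sym (ℕ.n∸n≡0 n))) ⟩
    ∑ (suc (suc n)) (λ j → g j * f (suc n ∸ j))
      ∎

  invCoeffsRev≡γ : ∀ n → invCoeffsRev n ≡ applyDownFrom γ (suc n)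
  invCoeffsRev≡γ zero    = refl
  invCoeffsRev≡γ (suc n) = cong₂ _∷_ leading (invCoeffsRev≡γ n)
    where
    leading : - foldr _+_ 0ℚ (zipWith _*_ (invCoeffsRev n) (map (λ i → E (suc i)) (upTo (suc n)))) ≡ γ (suc n)
    leading = begin
      - foldr _+_ 0ℚ (zipWith _*_ (invCoeffsRev n) (map (λ i → E (suc i)) (upTo (suc n))))
        ≡⟨ cong₂ (λ L M → - foldr _+_ 0ℚ (zipWith _*_ L M)) (invCoeffsRev≡γ n) (map-applyUpTo (λ i → i) (λ i → E (suc i)) (suc n)) ⟩
      - foldr _+_ 0ℚ (zipWith _*_ (applyDownFrom γ (suc n)) (applyUpTo (λ i → E (suc i)) (suc n)))
        ≡⟨ cong -_ (foldr-zipWith≡∑ n γ (λ i → E (suc i))) ⟩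
      - ∑ (suc n) (λ j → γ j * E (suc (n ∸ j)))
        ≡⟨ sym (γ[1+n]≡-∑γE n) ⟩
      γ (suc n)
        ∎

  B≡β : ∀ k → B k ≡ β k
  B≡β k = begin
    ιₙ (k !) * head0 (invCoeffsRev k)    ≡⟨ cong (λ L → ιₙ (k !) * head0 L) (invCoeffsRev≡γ k) ⟩
    ιₙ (k !) * (β k * 1/[ k !])          ≡⟨ x∙yz≈y∙xz (ιₙ (k !)) (β k) 1/[ k !] ⟩
    β k * (ιₙ (k !) * 1/[ k !])          ≡⟨ cong (β k *_) (ιₙ[n!]*1/[n!]≡1 k) ⟩
    β k * 1ℚ                             ≡⟨ ℚ.*-identityʳ (β k) ⟩
    β k                                  ∎

module IntegralScaling where

  open import Data.Nat as ℕ using (ℕ; zero; suc; _<_)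
  import Data.Nat.Properties as ℕ
  open import Data.Nat.DivMod using (m*n/n≡m)
  open import Data.Nat.Divisibility as ℕ∣ using (divides)
  open import Data.Integer as ℤ using (ℤ; +_; ∣_∣)
  import Data.Integer.Properties as ℤ
  open import Data.Integer.Divisibility.Signed
    using (_∣_; ∣m∣n⇒∣m+n; ∣m+n∣m⇒∣n; ∣m+n∣n⇒∣m; ∣ᵤ⇒∣; ∣⇒∣ᵤ) renaming (divides to divides±)
  open import Data.Rational using (ℚ; _+_; _*_; 1ℚ)
  import Data.Rational.Properties as ℚ
  open import Algebra.Structures using (IsCommutativeRing)
  open import Tactic.RingSolver using (solve-∀)
  open import Data.Sum using (inj₁; inj₂)
  open Rationals
  open Worpitzky using (sign; βterm; β)
  open Stirling using (surj)
  open FiniteSum ℤ.+-*-isCommutativeSemiring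
  module ℚ∑ = FiniteSum (IsCommutativeRing.isCommutativeSemiring ℚ.+-*-isCommutativeRing)

  ι-∑ : ∀ n f → ι (∑ n f) ≡ ℚ∑.∑ n (λ i → ι (f i))
  ι-∑ zero    f = refl
  ι-∑ (suc n) f = trans (ι-+ (∑ n f) (f n)) (cong (_+ ι (f n)) (ι-∑ n f))

  signℤ : ℕ → ℤ
  signℤ zero    = + 1
  signℤ (suc j) = ℤ.- signℤ j

  sign≡ι[signℤ] : ∀ j → sign j ≡ ι (signℤ j)
  sign≡ι[signℤ] zero    = refl
  sign≡ι[signℤ] (suc j) = trans (cong Data.Rational.-_ (sign≡ι[signℤ] j)) (sym (ι-neg (signℤ j)))

  ∣signℤ*x∣≡x : ∀ j x → ∣ signℤ j ℤ.* + x ∣ ≡ x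
  ∣signℤ*x∣≡x j x = trans (ℤ.abs-* (signℤ j) (+ x)) (trans (cong (ℕ._* x) (∣signℤ∣≡1 j)) (ℕ.*-identityˡ x))
    where
    ∣signℤ∣≡1 : ∀ j → ∣ signℤ j ∣ ≡ 1
    ∣signℤ∣≡1 zero    = refl
    ∣signℤ∣≡1 (suc j) = trans (ℤ.∣-i∣≡∣i∣ (signℤ j)) (∣signℤ∣≡1 j)

  sign*ιₙ*1/ₙ≡ι : ∀ j M → suc j ℕ∣.∣ M → sign j * ιₙ M * 1/ₙ (suc j) ≡ ι (signℤ j ℤ.* + (M ℕ./ suc j))
  sign*ιₙ*1/ₙ≡ι j M@.(c ℕ.* suc j) (divides c refl) = begin
    sign j * ιₙ (c ℕ.* suc j) * 1/ₙ (suc j)             ≡⟨ cong (λ x → sign j * x * 1/ₙ (suc j)) (ιₙ-* c (suc j)) ⟩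
    sign j * (ιₙ c * ιₙ (suc j)) * 1/ₙ (suc j)          ≡⟨ regroup (sign j) (ιₙ c) (ιₙ (suc j)) (1/ₙ (suc j)) ⟩
    sign j * ιₙ c * (ιₙ (suc j) * 1/ₙ (suc j))          ≡⟨ cong (sign j * ιₙ c *_) (ιₙ*1/ₙ≡1 (suc j)) ⟩
    sign j * ιₙ c * 1ℚ                                  ≡⟨ ℚ.*-identityʳ _ ⟩
    sign j * ιₙ c                                       ≡⟨ cong₂ _*_ (sign≡ι[signℤ] j) (cong ιₙ (sym (m*n/n≡m c (suc j)))) ⟩
    ι (signℤ j) * ιₙ (M ℕ./ suc j)                      ≡⟨ sym (ι-* (signℤ j) _) ⟩
    ι (signℤ j ℤ.* + (M ℕ./ suc j))                     ∎
    where
    open ≡-Reasoning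
    regroup : ∀ a b c d → a * (b * c) * d ≡ a * b * (c * d)
    regroup = solve-∀ ℚ-ring

  -- The division is exact wherever this is used, namely when (j+1) ∣ D * surj n j.
  scaledTerm : ℕ → ℕ → ℕ → ℤ
  scaledTerm D n j = signℤ j ℤ.* + ((D ℕ.* surj n j) ℕ./ suc j)

  ιₙ*β≡ι∑scaledTerm : ∀ D n → (∀ j → j < suc n → suc j ℕ∣.∣ D ℕ.* surj n j) →
                      ιₙ D * β n ≡ ι (∑ (suc n) (scaledTerm D n))
  ιₙ*β≡ι∑scaledTerm D n divisible = begin
    ιₙ D * ℚ∑.∑ (suc n) (βterm n)                        ≡⟨ ℚ∑.*-distribˡ-∑ (suc n) (ιₙ D) (βterm n) ⟩
    ℚ∑.∑ (suc n) (λ j → ιₙ D * βterm n j)                ≡⟨ ℚ∑.∑-cong-< (suc n) scale-term ⟩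
    ℚ∑.∑ (suc n) (λ j → ι (scaledTerm D n j))            ≡⟨ sym (ι-∑ (suc n) (scaledTerm D n)) ⟩
    ι (∑ (suc n) (scaledTerm D n))                       ∎
    where
    open ≡-Reasoning
    regroup : ∀ d s t i → d * (s * t * i) ≡ s * (d * t) * i
    regroup = solve-∀ ℚ-ring
    scale-term : ∀ j → j < suc n → ιₙ D * βterm n j ≡ ι (scaledTerm D n j)
    scale-term j j≤n = begin
      ιₙ D * (sign j * ιₙ (surj n j) * 1/ₙ (suc j))       ≡⟨ regroup (ιₙ D) (sign j) (ιₙ (surj n j)) (1/ₙ (suc j)) ⟩
      sign j * (ιₙ D * ιₙ (surj n j)) * 1/ₙ (suc j)       ≡⟨ cong (λ x → sign j * x * 1/ₙ (suc j)) (sym (ιₙ-* D (surj n j))) ⟩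
      sign j * ιₙ (D ℕ.* surj n j) * 1/ₙ (suc j)          ≡⟨ sign*ιₙ*1/ₙ≡ι j (D ℕ.* surj n j) (divisible j j≤n) ⟩
      ι (scaledTerm D n j)                                ∎

  ∣∑ : ∀ {k} n {f : ℕ → ℤ} → (∀ i → i < n → k ∣ f i) → k ∣ ∑ n f
  ∣∑ zero    _   = divides± (+ 0) refl
  ∣∑ (suc n) k∣f = ∣m∣n⇒∣m+n (∣∑ n (λ i i<n → k∣f i (ℕ.m<n⇒m<1+n i<n))) (k∣f n ℕ.≤-refl)

  ∣∑⇒∣term : ∀ {k} n {f : ℕ → ℤ} {i} → i < n → (∀ j → j < n → j ≢ i → k ∣ f j) → k ∣ ∑ n f → k ∣ f i
  ∣∑⇒∣term (suc n) {f} {i} i<1+n k∣others k∣∑ with ℕ.m≤n⇒m<n∨m≡n (ℕ.≤-pred i<1+n)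
  ... | inj₁ i<n = ∣∑⇒∣term n i<n (λ j j<n → k∣others j (ℕ.m<n⇒m<1+n j<n))
                             (∣m+n∣n⇒∣m k∣∑ (k∣others n ℕ.≤-refl (λ n≡i → ℕ.<-irrefl (sym n≡i) i<n)))
  ... | inj₂ refl = ∣m+n∣m⇒∣n k∣∑ (∣∑ n (λ j j<n → k∣others j (ℕ.m<n⇒m<1+n j<n) (λ j≡n → ℕ.<-irrefl j≡n j<n)))

  ∣scaledTerm∣≡ : ∀ D n j c → D ℕ.* surj n j ≡ c ℕ.* suc j → ∣ scaledTerm D n j ∣ ≡ c
  ∣scaledTerm∣≡ D n j c eq = trans (∣signℤ*x∣≡x j _) (trans (cong (ℕ._/ suc j) eq) (m*n/n≡m c (suc j)))

  ∣c⇒∣scaledTerm : ∀ {p} D n j c → D ℕ.* surj n j ≡ c ℕ.* suc j → p ℕ∣.∣ c → + p ∣ scaledTerm D n j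
  ∣c⇒∣scaledTerm {p} D n j c eq p∣c = ∣ᵤ⇒∣ (subst (p ℕ∣.∣_) (sym (∣scaledTerm∣≡ D n j c eq)) p∣c)

  ∣scaledTerm⇒∣c : ∀ {p} D n j c → D ℕ.* surj n j ≡ c ℕ.* suc j → + p ∣ scaledTerm D n j → p ℕ∣.∣ c
  ∣scaledTerm⇒∣c {p} D n j c eq p∣term = subst (p ℕ∣.∣_) (∣scaledTerm∣≡ D n j c eq) (∣⇒∣ᵤ p∣term)

module Denominator where

  open import Data.Nat as ℕ using (ℕ; suc; NonZero)
  open import Data.Nat.Coprimality using (Coprime; coprime⇒gcd≡1)
  open import Data.Nat.Divisibility using (_∣_; _∤_; _∣?_; ∣1⇒≡1; ∣m⇒∣m*n)
  open import Data.Nat.Primality using (Prime; euclidsLemma; productOfPrimes≢0)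
  open import Data.Nat.ListAction using (product)
  open import Data.Integer as ℤ using (ℤ; +_; ∣_∣)
  import Data.Integer.Properties as ℤ
  open import Data.Integer.GCD using (gcd)
  open import Data.Integer.Divisibility.Signed using (∣ᵤ⇒∣) renaming (_∣_ to _∣ℤ_)
  open import Data.Rational using (ℚ; _/_; 1ℚ; _*_; ↧_)
  import Data.Rational.Properties as ℚ
  open import Data.List using (List; filter)
  open import Data.List.Relation.Unary.All as All using (All)
  open import Data.List.Relation.Unary.All.Properties using (all-filter) renaming (filter⁺ to All-filter⁺)
  open import Data.List.Membership.Propositional using (_∈_)
  open import Data.List.Membership.Propositional.Properties using (∈-filter⁻)
  open import Data.List.Relation.Unary.Unique.Propositional using (Unique)
  open import Data.List.Relation.Unary.Unique.Propositional.Properties using (filter⁺)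
  open import Data.Product using (_,_)
  open import Data.Sum using (inj₁; inj₂)
  open import Relation.Nullary using (¬_)
  open import Relation.Nullary.Decidable using (¬?)
  open import Tactic.RingSolver using (solve-∀)
  open import Defs using (denom)
  open Rationals
  open Primes

  denom≡ : ∀ x D .{{_ : NonZero D}} M → x * ιₙ D ≡ ι M → Coprime ∣ M ∣ D → denom x ≡ D
  denom≡ x D@(suc _) M xD≡M coprime = ℤ.+-injective (begin
    ↧ x                                  ≡⟨ sym (ℤ.*-identityʳ (↧ x)) ⟩
    ↧ x ℤ.* + 1                          ≡⟨ cong (λ y → ↧ y ℤ.* + 1) x≡M/D ⟩
    ↧ (M / D) ℤ.* + 1                    ≡⟨ cong (λ g → ↧ (M / D) ℤ.* + g) (sym (coprime⇒gcd≡1 coprime)) ⟩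
    ↧ (M / D) ℤ.* gcd M (+ D)            ≡⟨ ℚ.↧-/ M D ⟩
    + D                                  ∎)
    where
    open ≡-Reasoning
    x≡M/D : x ≡ M / D
    x≡M/D = begin
      x                          ≡⟨ sym (ℚ.*-identityʳ x) ⟩
      x * 1ℚ                     ≡⟨ cong (x *_) (sym (ιₙ*1/ₙ≡1 D)) ⟩
      x * (ιₙ D * 1/ₙ D)         ≡⟨ sym (ℚ.*-assoc x (ιₙ D) (1/ₙ D)) ⟩
      x * ιₙ D * 1/ₙ D           ≡⟨ cong (_* 1/ₙ D) xD≡M ⟩
      ι M * 1/ₙ D                ≡⟨ sym (/≡ι*1/ₙ M D) ⟩
      M / D                      ∎

  denom[ι]≡1 : ∀ z → denom (ι z) ≡ 1
  denom[ι]≡1 z = denom≡ (ι z) 1 z (ℚ.*-identityʳ (ι z)) (λ (_ , d∣1) → ∣1⇒≡1 d∣1)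

  denom[c*x]≡ : ∀ {Q} → Unique Q → All Prime Q → ∀ x N → x * ιₙ (product Q) ≡ ι N → All (λ p → ¬ (+ p ∣ℤ N)) Q →
                ∀ c → denom (ιₙ c * x) ≡ product (filter (λ p → ¬? (p ∣? c)) Q)
  denom[c*x]≡ {Q} unique prime x N x*∏Q≡N p∤N c = denom≡ (ιₙ c * x) (product P) (+ c′ ℤ.* N) c*x*∏P≡ coprime
    where
    P Q₁ : List ℕ
    P  = filter (λ p → ¬? (p ∣? c)) Q
    Q₁ = filter (_∣? c) Q
    primeP : All Prime P
    primeP = All-filter⁺ (λ p → ¬? (p ∣? c)) prime
    instance
      ∏P≢0 : NonZero (product P)
      ∏P≢0 = productOfPrimes≢0 primeP
    ∏Q₁∣c : product Q₁ ∣ c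
    ∏Q₁∣c = product∣ (filter⁺ (_∣? c) unique) (All-filter⁺ (_∣? c) prime) (all-filter (_∣? c) Q)
    c′ = _∣_.quotient ∏Q₁∣c
    c≡c′*∏Q₁ : c ≡ c′ ℕ.* product Q₁
    c≡c′*∏Q₁ = _∣_.equality ∏Q₁∣c
    regroup : ∀ a b x p → a * b * x * p ≡ a * (x * (p * b))
    regroup = solve-∀ ℚ-ring
    c*x*∏P≡ : ιₙ c * x * ιₙ (product P) ≡ ι (+ c′ ℤ.* N)
    c*x*∏P≡ = begin
      ιₙ c * x * ιₙ (product P)                          ≡⟨ cong (λ y → ιₙ y * x * ιₙ (product P)) c≡c′*∏Q₁ ⟩
      ιₙ (c′ ℕ.* product Q₁) * x * ιₙ (product P)        ≡⟨ cong (λ y → y * x * ιₙ (product P)) (ιₙ-* c′ (product Q₁)) ⟩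
      ιₙ c′ * ιₙ (product Q₁) * x * ιₙ (product P)       ≡⟨ regroup (ιₙ c′) (ιₙ (product Q₁)) x (ιₙ (product P)) ⟩
      ιₙ c′ * (x * (ιₙ (product P) * ιₙ (product Q₁)))   ≡⟨ cong (λ y → ιₙ c′ * (x * y)) (sym (ιₙ-* (product P) (product Q₁))) ⟩
      ιₙ c′ * (x * ιₙ (product P ℕ.* product Q₁))        ≡⟨ cong (λ y → ιₙ c′ * (x * ιₙ y)) (product-filter (_∣? c) Q) ⟩
      ιₙ c′ * (x * ιₙ (product Q))                       ≡⟨ cong (ιₙ c′ *_) x*∏Q≡N ⟩
      ιₙ c′ * ι N                                        ≡⟨ sym (ι-* (+ c′) N) ⟩
      ι (+ c′ ℤ.* N)                                     ∎
      where open ≡-Reasoning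
    p∤c′N : ∀ {p} → p ∈ P → p ∤ ∣ + c′ ℤ.* N ∣
    p∤c′N {p} p∈P p∣c′N with ∈-filter⁻ (λ p → ¬? (p ∣? c)) {xs = Q} p∈P
    ... | p∈Q , p∤c with euclidsLemma c′ ∣ N ∣ (All.lookup primeP p∈P) (subst (p ∣_) (ℤ.abs-* (+ c′) N) p∣c′N)
    ...   | inj₁ p∣c′ = p∤c (subst (p ∣_) (sym c≡c′*∏Q₁) (∣m⇒∣m*n (product Q₁) p∣c′))
    ...   | inj₂ p∣N  = All.lookup p∤N p∈Q (∣ᵤ⇒∣ p∣N)
    coprime : Coprime ∣ + c′ ℤ.* N ∣ (product P)
    coprime = coprime-product primeP (All.tabulate p∤c′N)

module EvenIndex where

  open import Data.Nat as ℕ using (ℕ; zero; suc; _*_; _∸_; _<_; s≤s)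
  import Data.Nat.Properties as ℕ
  open import Data.Nat.Divisibility using (_∣_; _∤_; _∣?_; divides; ∣⇒≤; ∣m⇒∣m*n; ∣n⇒∣m*n)
  open import Data.Nat.Primality using (Prime; prime?; euclidsLemma; ¬prime[0])
  open import Data.Sum using (inj₁; inj₂)
  open import Data.Nat.ListAction using (product)
  open import Data.Nat.ListAction.Properties using (∈⇒∣product)
  open import Data.Integer using (+_)
  import Data.Integer.Properties as ℤ
  open import Data.Integer.Divisibility.Signed using () renaming (_∣_ to _∣ℤ_)
  open import Data.List using (List; filter; upTo)
  open import Data.List.Relation.Unary.All as All using (All)
  open import Data.List.Relation.Unary.All.Properties using (all-filter)
  open import Data.List.Membership.Propositional using (_∈_)
  open import Data.List.Membership.Propositional.Properties using (∈-filter⁺; ∈-filter⁻; ∈-upTo⁺)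
  open import Data.List.Relation.Unary.Unique.Propositional using (Unique)
  open import Data.List.Relation.Unary.Unique.Propositional.Properties using (filter⁺; upTo⁺)
  open import Data.Product using (Σ; _×_; _,_; proj₁; proj₂)
  open import Relation.Nullary using (¬_; Dec; contradiction)
  open import Relation.Nullary.Decidable using (_×-dec_)
  open import Data.Nat.Tactic.RingSolver using (solve-∀)
  open Stirling using (surj)
  open SurjModPrime using (prime∤surj)
  open SurjTerms
  open Primes
  open IntegralScaling
  open FiniteSum ℤ.+-*-isCommutativeSemiring using (∑)

  IsVonStaudtPrime : ℕ → ℕ → Set
  IsVonStaudtPrime n p = Prime p × (p ∸ 1) ∣ n

  isVonStaudtPrime? : ∀ n p → Dec (IsVonStaudtPrime n p)
  isVonStaudtPrime? n p = prime? p ×-dec ((p ∸ 1) ∣? n)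

  vonStaudtPrimes : ℕ → List ℕ
  vonStaudtPrimes n = filter (isVonStaudtPrime? n) (upTo (2 ℕ.+ n))

  vonStaudtPrimes-unique : ∀ n → Unique (vonStaudtPrimes n)
  vonStaudtPrimes-unique n = filter⁺ (isVonStaudtPrime? n) (upTo⁺ (2 ℕ.+ n))

  vonStaudtPrimes-prime : ∀ n → All Prime (vonStaudtPrimes n)
  vonStaudtPrimes-prime n = All.map proj₁ (all-filter (isVonStaudtPrime? n) (upTo (2 ℕ.+ n)))

  ∈vonStaudtPrimes⁻ : ∀ n {p} → p ∈ vonStaudtPrimes n → IsVonStaudtPrime n p
  ∈vonStaudtPrimes⁻ n p∈ = proj₂ (∈-filter⁻ (isVonStaudtPrime? n) {xs = upTo (2 ℕ.+ n)} p∈)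

  ∈vonStaudtPrimes⁺ : ∀ n {p} → 0 < n → IsVonStaudtPrime n p → p ∈ vonStaudtPrimes n
  ∈vonStaudtPrimes⁺ n {zero}  _   (pr , _)     = contradiction pr ¬prime[0]
  ∈vonStaudtPrimes⁺ n {suc p} 0<n (pr , p∣n) =
    ∈-filter⁺ (isVonStaudtPrime? n) (∈-upTo⁺ (s≤s (s≤s (∣⇒≤ {{ℕ.>-nonZero 0<n}} p∣n)))) (pr , p∣n)

  vonStaudtDenominator : ℕ → ℕ
  vonStaudtDenominator n = product (vonStaudtPrimes n)

  [1+j]∣denominator*surj : ∀ {n} → 0 < n → 2 ∣ n → ∀ j → suc j ∣ vonStaudtDenominator n * surj n j
  [1+j]∣denominator*surj {n} 0<n 2∣n j with classify n j
  ... | integral [1+j]∣surj = ∣n⇒∣m*n (vonStaudtDenominator n) [1+j]∣surj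
  ... | von-staudt pr j∣n   = ∣m⇒∣m*n (surj n j) (∈⇒∣product (∈vonStaudtPrimes⁺ n 0<n (pr , j∣n)))
  ... | exceptional _ 2∤n   = contradiction 2∣n 2∤n

  private
    cofactor : ∀ n {p} → p ∈ vonStaudtPrimes n → Σ ℕ λ d → vonStaudtDenominator n ≡ p * d × p ∤ d
    cofactor n = product≡p*cofactor (vonStaudtPrimes-unique n) (vonStaudtPrimes-prime n)

    reassociate : ∀ p d t → p * d * t ≡ d * t * p
    reassociate = solve-∀

  prime∤scaledTerm : ∀ {n s} → 0 < n → suc s ∈ vonStaudtPrimes n → ¬ (+ suc s ∣ℤ scaledTerm (vonStaudtDenominator n) n s)
  prime∤scaledTerm {n} {s} 0<n p∈ p∣term with cofactor n p∈
  ... | D′ , D≡pD′ , p∤D′ with euclidsLemma D′ (surj n s) pr (∣scaledTerm⇒∣c (vonStaudtDenominator n) n s (D′ * surj n s) D*surj≡ p∣term)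
    where
    pr : Prime (suc s)
    pr = proj₁ (∈vonStaudtPrimes⁻ n p∈)
    D*surj≡ : vonStaudtDenominator n * surj n s ≡ D′ * surj n s * suc s
    D*surj≡ = trans (cong (_* surj n s) D≡pD′) (reassociate (suc s) D′ (surj n s))
  ...   | inj₁ p∣D′   = p∤D′ p∣D′
  ...   | inj₂ p∣surj = prime∤surj (proj₁ (∈vonStaudtPrimes⁻ n p∈)) 0<n (proj₂ (∈vonStaudtPrimes⁻ n p∈)) p∣surj

  prime∣scaledTerm : ∀ {n s} j → 0 < n → 2 ∣ n → suc s ∈ vonStaudtPrimes n → j ≢ s →
                     + suc s ∣ℤ scaledTerm (vonStaudtDenominator n) n j
  prime∣scaledTerm {n} {s} j 0<n 2∣n p∈ j≢s with classify n j
  ... | integral (divides c surj≡c*[1+j]) =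
    ∣c⇒∣scaledTerm D n j (D * c) (trans (cong (D *_) surj≡c*[1+j]) (sym (ℕ.*-assoc D c (suc j)))) (∣m⇒∣m*n c (∈⇒∣product p∈))
    where D = vonStaudtDenominator n
  ... | exceptional _ 2∤n = contradiction 2∣n 2∤n
  ... | von-staudt prj j∣n with cofactor n (∈vonStaudtPrimes⁺ n 0<n (prj , j∣n))
  ...   | d , D≡[1+j]*d , _ =
    ∣c⇒∣scaledTerm (vonStaudtDenominator n) n j (d * surj n j) (trans (cong (_* surj n j) D≡[1+j]*d) (reassociate (suc j) d (surj n j)))
                   (∣m⇒∣m*n (surj n j) p∣d)
    where
    pr : Prime (suc s)
    pr = proj₁ (∈vonStaudtPrimes⁻ n p∈)
    p∣d : suc s ∣ d
    p∣d = ∤m∧∣m*n⇒∣n pr (λ p∣[1+j] → j≢s (sym (ℕ.suc-injective (prime∣prime⇒≡ pr prj p∣[1+j]))))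
                      (subst (suc s ∣_) D≡[1+j]*d (∈⇒∣product p∈))

  ∤∑scaledTerm : ∀ {n p} → 0 < n → 2 ∣ n → p ∈ vonStaudtPrimes n →
                 ¬ (+ p ∣ℤ ∑ (suc n) (scaledTerm (vonStaudtDenominator n) n))
  ∤∑scaledTerm {n} {zero}  _   _   p∈ _   = ¬prime[0] (proj₁ (∈vonStaudtPrimes⁻ n p∈))
  ∤∑scaledTerm {n} {suc s} 0<n 2∣n p∈ p∣∑ =
    prime∤scaledTerm 0<n p∈ (∣∑⇒∣term (suc n) s<1+n (λ j _ j≢s → prime∣scaledTerm j 0<n 2∣n p∈ j≢s) p∣∑)
    where
    s<1+n : s < suc n
    s<1+n = s≤s (∣⇒≤ {{ℕ.>-nonZero 0<n}} (proj₂ (∈vonStaudtPrimes⁻ n p∈)))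

module OddIndex where

  open import Data.Nat as ℕ using (ℕ; zero; suc; _+_; _*_)
  import Data.Nat.Properties as ℕ
  open import Data.Nat.Divisibility using (_∣_; divides; ∣-trans; m∣m*n; ∣n⇒∣m*n; ∣m+n∣m⇒∣n; ∣1⇒≡1)
  open import Data.Nat.DivMod using (m*n/n≡m)
  open import Data.Nat.Primality using (Prime; prime[2])
  open import Data.Integer as ℤ using (ℤ; +_; -[1+_])
  import Data.Integer.Properties as ℤ
  open import Data.Integer.Divisibility.Signed using (∣m∣n⇒∣m+n) renaming (_∣_ to _∣ℤ_; divides to dividesℤ)
  open import Data.Integer.Tactic.RingSolver using () renaming (solve-∀ to solveℤ-∀)
  open import Data.Nat.Tactic.RingSolver using (solve-∀)
  open import Data.Product using (Σ; _,_)
  open import Data.Sum using (_⊎_; inj₁; inj₂)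
  open import Relation.Nullary using (¬_; contradiction)
  import Data.Rational as ℚ
  import Data.Rational.Properties as ℚ
  open Rationals
  open Worpitzky using (β)
  open Stirling using (surj)
  open StirlingParity using (S₂[1+n,1]≡1; surj[2m+3,3]≡6*odd)
  open SurjTerms
  open Primes using (prime∣prime⇒≡)
  open IntegralScaling
  open FiniteSum ℤ.+-*-isCommutativeSemiring using (∑; ∑-uncons)

  2∣n⊎2∣1+n : ∀ n → 2 ∣ n ⊎ 2 ∣ suc n
  2∣n⊎2∣1+n zero    = inj₁ (divides 0 refl)
  2∣n⊎2∣1+n (suc n) with 2∣n⊎2∣1+n n
  ... | inj₁ (divides q n≡2q) = inj₂ (divides (suc q) (cong (λ x → suc (suc x)) n≡2q))
  ... | inj₂ 2∣1+n            = inj₁ 2∣1+n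

  2∤3+2m : ∀ m → ¬ (2 ∣ 3 + 2 * m)
  2∤3+2m m 2∣3+2m with ∣1⇒≡1 (∣m+n∣m⇒∣n (subst (2 ∣_) (regroup m) 2∣3+2m) (m∣m*n (suc m)))
    where
    regroup : ∀ m → 3 + 2 * m ≡ 2 * suc m + 1
    regroup = solve-∀
  ... | ()

  prime∧∣odd⇒≡1 : ∀ {j n} → Prime (suc j) → j ∣ n → ¬ (2 ∣ n) → j ≡ 1
  prime∧∣odd⇒≡1 {j} pr j∣n 2∤n with 2∣n⊎2∣1+n j
  ... | inj₁ 2∣j   = contradiction (∣-trans 2∣j j∣n) 2∤n
  ... | inj₂ 2∣1+j = ℕ.suc-injective (sym (prime∣prime⇒≡ prime[2] pr 2∣1+j))

  [1+j]∣2*surj : ∀ m j → suc j ∣ 2 * surj (3 + 2 * m) j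
  [1+j]∣2*surj m j with classify (3 + 2 * m) j
  ... | integral [1+j]∣surj = ∣n⇒∣m*n 2 [1+j]∣surj
  ... | von-staudt pr j∣n with prime∧∣odd⇒≡1 pr j∣n (2∤3+2m m)
  ...   | refl = m∣m*n (surj (3 + 2 * m) 1)
  [1+j]∣2*surj m j | exceptional refl _ with surj[2m+3,3]≡6*odd m
  ...   | t , surj≡6[1+2t] = divides (3 * (1 + 2 * t)) (trans (cong (2 *_) surj≡6[1+2t]) (regroup t))
    where
    regroup : ∀ t → 2 * (6 * (1 + 2 * t)) ≡ 3 * (1 + 2 * t) * 4
    regroup = solve-∀

  -1-3[1+2t]≡-[2+3t]*2 : ∀ t → -[1+ 0 ] ℤ.+ ℤ.- (+ (3 * (1 + 2 * t))) ≡ ℤ.- (+ (2 + 3 * t)) ℤ.* + 2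
  -1-3[1+2t]≡-[2+3t]*2 t = begin
    ℤ.- (+ 1) ℤ.+ ℤ.- (+ (3 * (1 + 2 * t)))   ≡⟨ sym (ℤ.neg-distrib-+ (+ 1) (+ (3 * (1 + 2 * t)))) ⟩
    ℤ.- (+ 1 ℤ.+ + (3 * (1 + 2 * t)))         ≡⟨ cong ℤ.-_ (sym (ℤ.pos-+ 1 (3 * (1 + 2 * t)))) ⟩
    ℤ.- (+ (1 + 3 * (1 + 2 * t)))             ≡⟨ cong (λ x → ℤ.- (+ x)) (regroup t) ⟩
    ℤ.- (+ ((2 + 3 * t) * 2))                 ≡⟨ neg-double (2 + 3 * t) ⟩
    ℤ.- (+ (2 + 3 * t)) ℤ.* + 2               ∎
    where
    open ≡-Reasoning
    regroup : ∀ t → 1 + 3 * (1 + 2 * t) ≡ (2 + 3 * t) * 2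
    regroup = solve-∀
    neg-double : ∀ x → ℤ.- (+ (x * 2)) ≡ ℤ.- (+ x) ℤ.* + 2
    neg-double x = trans (cong ℤ.-_ (ℤ.pos-* x 2)) (ℤ.neg-distribˡ-* (+ x) (+ 2))

  2∣scaledTerm : ∀ m j → j ≢ 1 → j ≢ 3 → + 2 ∣ℤ scaledTerm 2 (3 + 2 * m) j
  2∣scaledTerm m j j≢1 j≢3 with classify (3 + 2 * m) j
  ... | integral (divides c surj≡c*[1+j]) =
    ∣c⇒∣scaledTerm 2 (3 + 2 * m) j (2 * c) (trans (cong (2 *_) surj≡c*[1+j]) (sym (ℕ.*-assoc 2 c (suc j)))) (m∣m*n c)
  ... | von-staudt pr j∣n  = contradiction (prime∧∣odd⇒≡1 pr j∣n (2∤3+2m m)) j≢1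
  ... | exceptional j≡3 _ = contradiction j≡3 j≢3

  2∣scaledTerm₁+scaledTerm₃ : ∀ m → + 2 ∣ℤ scaledTerm 2 (3 + 2 * m) 1 ℤ.+ scaledTerm 2 (3 + 2 * m) 3
  2∣scaledTerm₁+scaledTerm₃ m with surj[2m+3,3]≡6*odd m
  ... | t , surj≡6[1+2t] = dividesℤ (ℤ.- (+ (2 + 3 * t))) (begin
    scaledTerm 2 (3 + 2 * m) 1 ℤ.+ scaledTerm 2 (3 + 2 * m) 3   ≡⟨ cong₂ ℤ._+_ term₁≡-1 term₃≡ ⟩
    -[1+ 0 ] ℤ.+ ℤ.- (+ (3 * (1 + 2 * t)))                     ≡⟨ -1-3[1+2t]≡-[2+3t]*2 t ⟩
    ℤ.- (+ (2 + 3 * t)) ℤ.* + 2                                 ∎)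
    where
    open ≡-Reasoning
    term₁≡-1 : scaledTerm 2 (3 + 2 * m) 1 ≡ -[1+ 0 ]
    term₁≡-1 = cong (λ s → signℤ 1 ℤ.* + ((2 * (1 * s)) ℕ./ 2)) (S₂[1+n,1]≡1 (2 + 2 * m))
    regroup : ∀ t → 2 * (6 * (1 + 2 * t)) ≡ 3 * (1 + 2 * t) * 4
    regroup = solve-∀
    term₃≡ : scaledTerm 2 (3 + 2 * m) 3 ≡ ℤ.- (+ (3 * (1 + 2 * t)))
    term₃≡ = begin
      signℤ 3 ℤ.* + ((2 * surj (3 + 2 * m) 3) ℕ./ 4)   ≡⟨ cong (λ s → signℤ 3 ℤ.* + ((2 * s) ℕ./ 4)) surj≡6[1+2t] ⟩
      signℤ 3 ℤ.* + ((2 * (6 * (1 + 2 * t))) ℕ./ 4)   ≡⟨ cong (λ x → signℤ 3 ℤ.* + (x ℕ./ 4)) (regroup t) ⟩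
      signℤ 3 ℤ.* + ((3 * (1 + 2 * t) * 4) ℕ./ 4)     ≡⟨ cong (λ x → signℤ 3 ℤ.* + x) (m*n/n≡m (3 * (1 + 2 * t)) 4) ⟩
      signℤ 3 ℤ.* + (3 * (1 + 2 * t))                 ≡⟨ ℤ.-1*i≡-i _ ⟩
      ℤ.- (+ (3 * (1 + 2 * t)))                       ∎

  2∣∑scaledTerm : ∀ m → + 2 ∣ℤ ∑ (suc (3 + 2 * m)) (scaledTerm 2 (3 + 2 * m))
  2∣∑scaledTerm m = subst (+ 2 ∣ℤ_) (sym decompose)
    (∣m∣n⇒∣m+n (∣m∣n⇒∣m+n (∣m∣n⇒∣m+n (2∣scaledTerm m 0 (λ ()) (λ ())) (2∣scaledTerm m 2 (λ ()) (λ ())))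
                           (∣∑ (2 * m) (λ i _ → 2∣scaledTerm m (4 + i) (λ ()) (λ ()))))
               (2∣scaledTerm₁+scaledTerm₃ m))
    where
    open ≡-Reasoning
    E = scaledTerm 2 (3 + 2 * m)
    R = ∑ (2 * m) (λ i → E (4 + i))
    rearrange : ∀ a b c d r → a ℤ.+ (b ℤ.+ (c ℤ.+ (d ℤ.+ r))) ≡ (a ℤ.+ c ℤ.+ r) ℤ.+ (b ℤ.+ d)
    rearrange = solveℤ-∀
    decompose : ∑ (suc (3 + 2 * m)) E ≡ (E 0 ℤ.+ E 2 ℤ.+ R) ℤ.+ (E 1 ℤ.+ E 3)
    decompose = begin
      ∑ (suc (3 + 2 * m)) E                                         ≡⟨ ∑-uncons (3 + 2 * m) E ⟩
      E 0 ℤ.+ ∑ (3 + 2 * m) (λ i → E (1 + i))                       ≡⟨ cong (λ x → E 0 ℤ.+ x) (∑-uncons (2 + 2 * m) _) ⟩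
      E 0 ℤ.+ (E 1 ℤ.+ ∑ (2 + 2 * m) (λ i → E (2 + i)))             ≡⟨ cong (λ x → E 0 ℤ.+ (E 1 ℤ.+ x)) (∑-uncons (1 + 2 * m) _) ⟩
      E 0 ℤ.+ (E 1 ℤ.+ (E 2 ℤ.+ ∑ (1 + 2 * m) (λ i → E (3 + i))))   ≡⟨ cong (λ x → E 0 ℤ.+ (E 1 ℤ.+ (E 2 ℤ.+ x))) (∑-uncons (2 * m) _) ⟩
      E 0 ℤ.+ (E 1 ℤ.+ (E 2 ℤ.+ (E 3 ℤ.+ R)))                       ≡⟨ rearrange (E 0) (E 1) (E 2) (E 3) R ⟩
      (E 0 ℤ.+ E 2 ℤ.+ R) ℤ.+ (E 1 ℤ.+ E 3)                         ∎

  β[3+2m]-integral : ∀ m → Σ ℤ λ z → β (3 + 2 * m) ≡ ι z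
  β[3+2m]-integral m = q , ιₙ*-cancelˡ 2 (β n) (ι q) (begin
    ιₙ 2 ℚ.* β n       ≡⟨ ιₙ*β≡ι∑scaledTerm 2 n (λ j _ → [1+j]∣2*surj m j) ⟩
    ι N                ≡⟨ cong ι (_∣ℤ_.equality (2∣∑scaledTerm m)) ⟩
    ι (q ℤ.* + 2)      ≡⟨ ι-* q (+ 2) ⟩
    ι q ℚ.* ιₙ 2       ≡⟨ ℚ.*-comm (ι q) (ιₙ 2) ⟩
    ιₙ 2 ℚ.* ι q       ∎)
    where
    open ≡-Reasoning
    n = 3 + 2 * m
    N = ∑ (suc n) (scaledTerm 2 n)
    q = _∣ℤ_.quotient (2∣∑scaledTerm m)

open import Defs
open import Data.Nat as ℕ using (ℕ; zero; suc; _≤_; _<_; s≤s; z≤n)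
import Data.Nat.Properties as ℕ
open import Data.Nat.Combinatorics using (_C_; nC1≡n)
open import Data.Nat.Divisibility using (_∣_; _∣?_; divides; ∣-refl; ∣m∣n⇒∣m+n)
open import Data.Nat.Primality using (prime[2])
open import Data.Nat.Coprimality using (Coprime)
open import Data.Nat.ListAction using (product)
open import Data.Nat.Tactic.RingSolver using (solve-∀)
open import Data.Integer as ℤ using (+_)
import Data.Integer.Properties as ℤ
open import Data.Rational using (_*_; _/_)
import Data.Rational.Properties as ℚ
open import Data.List using (List; []; _∷_; filter)
open import Data.List.Relation.Unary.All as All using (All)
open import Data.List.Relation.Unary.Any using (here)
open import Data.List.Relation.Unary.AllPairs using ([]; _∷_)
open import Data.List.Membership.Propositional using (_∈_)
open import Data.List.Membership.Propositional.Properties using (∈-filter⁺; ∈-filter⁻)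
open import Data.List.Relation.Unary.Unique.Propositional using (Unique)
open import Data.List.Relation.Unary.Unique.Propositional.Properties using (filter⁺)
open import Data.Product using (Σ; _×_; _,_; proj₁; proj₂)
open import Function.Bundles using (_⇔_; mk⇔)
open import Relation.Nullary using (¬_; yes; no; contradiction)
open import Relation.Nullary.Decidable using (¬?)
open Rationals
open Worpitzky using (β)
open BernoulliNumbers using (B≡β)
open FiniteSum ℤ.+-*-isCommutativeSemiring using (∑)
open IntegralScaling using (scaledTerm; ιₙ*β≡ι∑scaledTerm)
open Denominator
open Primes
open EvenIndex
open OddIndex

DenominatorPrimes : ℕ → ℕ → Set
DenominatorPrimes m k = Σ (List ℕ) λ P → Unique P × ((p : ℕ) → (p ∈ P) ⇔ InP m k p) × denom (ιₙ (m C k) * B k) ≡ product P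

denominatorPrimes-0 : ∀ m → DenominatorPrimes m 0
denominatorPrimes-0 m = [] , [] , (λ p → mk⇔ (λ ()) (λ { (k≡1 () _ _) ; (k-even () _ _ _ _) })) , refl

B₁*2≡-1 : B 1 * ιₙ 2 ≡ ι (ℤ.- (+ 1))
B₁*2≡-1 = refl

ιₙ[mC1]*B₁*2≡-m : ∀ m → ιₙ (m C 1) * B 1 * ιₙ 2 ≡ ι (ℤ.- (+ m))
ιₙ[mC1]*B₁*2≡-m m = begin
  ιₙ (m C 1) * B 1 * ιₙ 2      ≡⟨ ℚ.*-assoc (ιₙ (m C 1)) (B 1) (ιₙ 2) ⟩
  ιₙ (m C 1) * ι (ℤ.- (+ 1))   ≡⟨ cong₂ _*_ (cong ιₙ (nC1≡n m)) B₁*2≡-1 ⟩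
  ι (+ m) * ι (ℤ.- (+ 1))      ≡⟨ sym (ι-* (+ m) (ℤ.- (+ 1))) ⟩
  ι (+ m ℤ.* ℤ.- (+ 1))        ≡⟨ cong ι (trans (ℤ.*-comm (+ m) (ℤ.- (+ 1))) (ℤ.-1*i≡-i (+ m))) ⟩
  ι (ℤ.- (+ m))                ∎
  where open ≡-Reasoning

denominatorPrimes-1 : ∀ m → DenominatorPrimes m 1
denominatorPrimes-1 m with 2 ∣? m
... | yes 2∣m@(divides q m≡q*2) =
  [] , [] , (λ p → mk⇔ (λ ()) λ { (k≡1 _ 2∤m _) → contradiction 2∣m 2∤m ; (k-even (s≤s ()) _ _ _ _) }) ,
  trans (cong denom x≡-q) (denom[ι]≡1 (ℤ.- (+ q)))
  where
  x≡-q : ιₙ (m C 1) * B 1 ≡ ι (ℤ.- (+ q))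
  x≡-q = ιₙ*-cancelˡ 2 _ _ (begin
    ιₙ 2 * (ιₙ (m C 1) * B 1)       ≡⟨ ℚ.*-comm (ιₙ 2) (ιₙ (m C 1) * B 1) ⟩
    ιₙ (m C 1) * B 1 * ιₙ 2         ≡⟨ ιₙ[mC1]*B₁*2≡-m m ⟩
    ι (ℤ.- (+ m))                   ≡⟨ cong (λ x → ι (ℤ.- (+ x))) m≡q*2 ⟩
    ι (ℤ.- (+ (q ℕ.* 2)))           ≡⟨ cong ι (trans (cong ℤ.-_ (ℤ.pos-* q 2)) (ℤ.neg-distribˡ-* (+ q) (+ 2))) ⟩
    ι (ℤ.- (+ q) ℤ.* + 2)           ≡⟨ ι-* (ℤ.- (+ q)) (+ 2) ⟩
    ι (ℤ.- (+ q)) * ιₙ 2            ≡⟨ ℚ.*-comm (ι (ℤ.- (+ q))) (ιₙ 2) ⟩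
    ιₙ 2 * ι (ℤ.- (+ q))            ∎)
    where open ≡-Reasoning
... | no  2∤m =
  2 ∷ [] , All.[] ∷ [] ,
  (λ p → mk⇔ (λ { (here refl) → k≡1 refl 2∤m refl }) (λ { (k≡1 _ _ refl) → here refl ; (k-even (s≤s ()) _ _ _ _) })) ,
  denom≡ (ιₙ (m C 1) * B 1) 2 (ℤ.- (+ m)) (ιₙ[mC1]*B₁*2≡-m m)
         (subst (λ a → Coprime a 2) (sym (ℤ.∣-i∣≡∣i∣ (+ m))) (coprime-prime prime[2] 2∤m))

-- k is tied to 3 + 2j by an equation rather than by unification: making B k and B (3 + 2 * j) meet in a
-- type would let the type checker unfold the Bernoulli recursion.
denominatorPrimes-odd : ∀ m k j → k ≡ 3 ℕ.+ 2 ℕ.* j → DenominatorPrimes m k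
denominatorPrimes-odd m k j k≡3+2j =
  [] , [] , (λ p → mk⇔ (λ ()) λ { (k≡1 k≡1′ _ _) → contradiction (trans (sym k≡3+2j) k≡1′) 3+2j≢1
                                ; (k-even _ 2∣k _ _ _) → contradiction (subst (2 ∣_) k≡3+2j 2∣k) (2∤3+2m j) }) ,
  trans (cong denom x≡ι) (denom[ι]≡1 (+ (m C k) ℤ.* z))
  where
  z = proj₁ (β[3+2m]-integral j)
  3+2j≢1 : 3 ℕ.+ 2 ℕ.* j ≢ 1
  3+2j≢1 ()
  x≡ι : ιₙ (m C k) * B k ≡ ι (+ (m C k) ℤ.* z)
  x≡ι = trans (cong (ιₙ (m C k) *_) (trans (B≡β k) (subst (λ n → β n ≡ ι z) (sym k≡3+2j) (proj₂ (β[3+2m]-integral j)))))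
              (sym (ι-* (+ (m C k)) z))

denominatorPrimes-even : ∀ m k → 2 ≤ k → 2 ∣ k → DenominatorPrimes m k
denominatorPrimes-even m k 2≤k 2∣k =
  filter (λ p → ¬? (p ∣? (m C k))) (vonStaudtPrimes k) ,
  filter⁺ (λ p → ¬? (p ∣? (m C k))) (vonStaudtPrimes-unique k) ,
  membership ,
  denom[c*x]≡ (vonStaudtPrimes-unique k) (vonStaudtPrimes-prime k) (B k) _ B*D≡N (All.tabulate (∤∑scaledTerm 0<k 2∣k)) (m C k)
  where
  0<k : 0 < k
  0<k = ℕ.<-trans (s≤s z≤n) 2≤k
  B*D≡N : B k * ιₙ (vonStaudtDenominator k) ≡ ι (∑ (suc k) (scaledTerm (vonStaudtDenominator k) k))
  B*D≡N = trans (cong (_* ιₙ (vonStaudtDenominator k)) (B≡β k))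
                (trans (ℚ.*-comm (β k) (ιₙ (vonStaudtDenominator k)))
                       (ιₙ*β≡ι∑scaledTerm (vonStaudtDenominator k) k (λ j _ → [1+j]∣denominator*surj 0<k 2∣k j)))
  membership : (p : ℕ) → (p ∈ filter (λ p → ¬? (p ∣? (m C k))) (vonStaudtPrimes k)) ⇔ InP m k p
  membership p = mk⇔ to from
    where
    to : p ∈ filter (λ p → ¬? (p ∣? (m C k))) (vonStaudtPrimes k) → InP m k p
    to p∈P with ∈-filter⁻ (λ p → ¬? (p ∣? (m C k))) {xs = vonStaudtPrimes k} p∈P
    ... | p∈Q , p∤C = k-even 2≤k 2∣k (proj₁ (∈vonStaudtPrimes⁻ k p∈Q)) (proj₂ (∈vonStaudtPrimes⁻ k p∈Q)) p∤C
    from : InP m k p → p ∈ filter (λ p → ¬? (p ∣? (m C k))) (vonStaudtPrimes k)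
    from (k≡1 refl _ _)            = contradiction 2≤k (λ { (s≤s ()) })
    from (k-even _ _ pr p-1∣k p∤C) = ∈-filter⁺ (λ p → ¬? (p ∣? (m C k))) (∈vonStaudtPrimes⁺ k 0<k (pr , p-1∣k)) p∤C

2∤2+k⇒≡3+2j : ∀ k → ¬ (2 ∣ 2 ℕ.+ k) → Σ ℕ λ j → 2 ℕ.+ k ≡ 3 ℕ.+ 2 ℕ.* j
2∤2+k⇒≡3+2j zero          2∤2   = contradiction (divides 1 refl) 2∤2
2∤2+k⇒≡3+2j (suc zero)    _     = 0 , refl
2∤2+k⇒≡3+2j (suc (suc k)) 2∤4+k with 2∤2+k⇒≡3+2j k (λ 2∣2+k → 2∤4+k (∣m∣n⇒∣m+n ∣-refl 2∣2+k))
... | j , 2+k≡3+2j = suc j , trans (cong (λ x → suc (suc x)) 2+k≡3+2j) (step j)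
  where
  step : ∀ j → 5 ℕ.+ 2 ℕ.* j ≡ 3 ℕ.+ 2 ℕ.* suc j
  step = solve-∀

lemma3 : (m k : ℕ) → k ≤ m →
    Σ (List ℕ) (λ P → Unique P × ((p : ℕ) → (p ∈ P) ⇔ InP m k p)
      × denom (((+ (m C k)) / 1) * B k) ≡ product P)
lemma3 m zero          _ = denominatorPrimes-0 m
lemma3 m (suc zero)    _ = denominatorPrimes-1 m
lemma3 m (suc (suc k)) _ with 2 ∣? suc (suc k)
... | yes 2∣k = denominatorPrimes-even m (suc (suc k)) (s≤s (s≤s z≤n)) 2∣k
... | no  2∤k with 2∤2+k⇒≡3+2j k 2∤k
...   | j , 2+k≡3+2j = denominatorPrimes-odd m (suc (suc k)) j 2+k≡3+2j
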